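{- Let $r\ge1$, $n=2r$, and let $\lambda=(n-j,1^j)$ be a hook partition of $n$, $0\le j\le n-1$. Then $$g_{(r,r)\lambda}=\begin{cases}0 & \text{if } j<r,\\ (-1)^{r+j} & \text{if } j\ge r.\end{cases}$$
   Context: For a partition $\mu$, $P_\mu(x;t)$ denotes the Hall–Littlewood $P$-function, which is well defined at $t=-1$ for every partition $\mu$. For partitions $\mu,\lambda$ the integers $g_{\mu\lambda}$ are defined by the expansion $P_\mu(x;-1)=\sum_\lambda g_{\mu\lambda}s_\lambda(x)$ in Schur functions $s_\lambda$. Here $(r,r)$ is the partition with two parts equal to $r$. -}

module Defs where

open import Data.Bool using (Bool; true; false; if_then_else_; _∧_)
open import Data.Nat using (ℕ; zero; suc; _∸_; _≡ᵇ_; _<ᵇ_; _⊓_) renaming (_+_ to _+ℕ_)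
open import Data.List using (List; []; _∷_; map; concatMap; upTo; filterᵇ; reverse; foldr; length; replicate)
open import Data.Integer using (ℤ; +_; -[1+_]; _+_; _*_; _-_; _^_)

-- Partitions are represented as lists of positive naturals in weakly
-- decreasing order (no trailing zeros), e.g. (r,r) = r ∷ r ∷ [].

range : ℕ → ℕ → List ℕ
range a b = map (a +ℕ_) (upTo (suc b ∸ a))

sumℕ : List ℕ → ℕ
sumℕ = foldr _+ℕ_ 0

sumℤ : List ℤ → ℤ
sumℤ = foldr _+_ (+ 0)

prodℤ : List ℤ → ℤ
prodℤ = foldr _*_ (+ 1)

stripZ : List ℕ → List ℕ
stripZ [] = []
stripZ (x ∷ xs) with stripZ xs
... | [] = if x ≡ᵇ 0 then [] else x ∷ []
... | y ∷ ys = x ∷ y ∷ ys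

-- all lists ν (same length as μ) interlacing μ:
-- μ₁ ≥ ν₁ ≥ μ₂ ≥ ν₂ ≥ … ≥ μ_ℓ ≥ ν_ℓ ≥ 0
interlace : List ℕ → List (List ℕ)
interlace [] = [] ∷ []
interlace (m ∷ []) = map (λ k → k ∷ []) (range 0 m)
interlace (m ∷ m' ∷ ms) =
  concatMap (λ k → map (k ∷_) (interlace (m' ∷ ms))) (range m' m)

-- all partitions ν ⊆ μ such that μ/ν is a horizontal strip of size a
hstrips : List ℕ → ℕ → List (List ℕ)
hstrips μ a = filterᵇ (λ ν → sumℕ μ ≡ᵇ (a +ℕ sumℕ ν)) (map stripZ (interlace μ))

conj : List ℕ → ℕ → ℕ
conj μ j = length (filterᵇ (λ x → (x <ᵇ j) ≡ᵇB false) μ)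
  where
  _≡ᵇB_ : Bool → Bool → Bool
  false ≡ᵇB false = true
  true ≡ᵇB true = true
  _ ≡ᵇB _ = false

mult : List ℕ → ℕ → ℕ
mult ν j = length (filterᵇ (_≡ᵇ j) ν)

-- Macdonald III (5.8'): for a horizontal strip θ = μ/ν,
-- ψ_{μ/ν}(t) = ∏_{j ∈ J} (1 - t^{m_j(ν)}),
-- J = { j ≥ 1 : θ'_j = 0 and θ'_{j+1} = 1 }, θ'_j = μ'_j - ν'_j.
-- (j ranges over 1..μ₁, since θ'_{j+1} = 0 for j ≥ μ₁.)
headℕ : List ℕ → ℕ
headℕ [] = 0
headℕ (x ∷ _) = x

ψ : ℤ → List ℕ → List ℕ → ℤ
ψ t μ ν = prodℤ (map factor (range 1 (headℕ μ)))
  where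
  θ' : ℕ → ℕ
  θ' j = conj μ j ∸ conj ν j
  factor : ℕ → ℤ
  factor j = if (θ' j ≡ᵇ 0) ∧ (θ' (suc j) ≡ᵇ 1)
             then + 1 - t ^ mult ν j
             else + 1

-- Sum over chains ∅ = μ⁽⁰⁾ ⊆ … ⊆ μ⁽ᴺ⁾ = μ of horizontal strips, where the
-- list argument is (α_N, …, α_1) and μ⁽ⁱ⁾/μ⁽ⁱ⁻¹⁾ has size α_i; each strip is
-- weighted by w.  (Chains of horizontal strips = semistandard tableaux.)
chainSum : (List ℕ → List ℕ → ℤ) → List ℕ → List ℕ → ℤ
chainSum w μ [] with μ
... | [] = + 1
... | _ ∷ _ = + 0
chainSum w μ (a ∷ as) = sumℤ (map (λ ν → w μ ν * chainSum w ν as) (hstrips μ a))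

-- coefficient of x^α = x₁^{α₁}⋯x_N^{α_N} in the Hall–Littlewood function
-- P_μ(x₁,…,x_N; t)   (Macdonald III (5.11'): P_μ = Σ_T ψ_T(t) x^T)
coeffP : ℤ → List ℕ → List ℕ → ℤ
coeffP t μ α = chainSum (ψ t) μ (reverse α)

-- coefficient of x^α in the Schur function s_λ(x₁,…,x_N)
-- (= Kostka number: number of SSYT of shape λ and content α)
coeffS : List ℕ → List ℕ → ℤ
coeffS la α = chainSum (λ _ _ → + 1) la (reverse α)

-- all partitions of n with parts ≤ m (fuel f ≥ n suffices)
partsF : ℕ → ℕ → ℕ → List (List ℕ)
partsF f zero m = [] ∷ []
partsF zero (suc n) m = []
partsF (suc f) (suc n) m =
  concatMap (λ k → map (k ∷_) (partsF f (suc n ∸ k) k)) (range 1 (m ⊓ suc n))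

partitions : ℕ → List (List ℕ)
partitions n = partsF n n n

minus1 : ℤ
minus1 = -[1+ 0 ]

hook : ℕ → ℕ → List ℕ
hook n j = (n ∸ j) ∷ replicate j 1

-- g is the family of Schur coefficients of P_μ(x;-1), for μ ⊢ n:
-- P_μ(x;-1) = Σ_{λ ⊢ n} g λ s_λ(x), checked coefficientwise in
-- every finite number N of variables (α ranges over all of ℕ^N, all N).
IsSchurExpansion : List ℕ → ℕ → (List ℕ → ℤ) → Set
IsSchurExpansion μ n g =
  (α : List ℕ) → coeffP minus1 μ α ≡ sumℤ (map (λ λ' → g λ' * coeffS λ' α) (partitions n))
  where open import Relation.Binary.PropositionalEquality using (_≡_)

-- Apply to both sides of P_(r,r)(x;-1) = Σ_λ g_λ s_λ(x) the functional ⟨-, h_a e_j⟩, a = 2r - j,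
-- computed as the coefficient of x_N^a followed by pairing with e_j.  Branching over the horizontal
-- strips removed by x_N reduces it to ⟨s_ν, e_j⟩ = [ν = (1^j)] and to ⟨P_ν(x;-1), e_j⟩, which is
-- [j = y] for ν = (y) and 0 for ν = (p, s) with 0 < s < p: the values of ψ at t = -1 on the strips
-- these branch into are 2, …, 2, 1 and 1, 2, …, 2, 1 respectively, with alternating sums 1 and 0.
-- Only the hooks (a, 1^j) and (a + 1, 1^(j-1)) survive on the Schur side and only the strip
-- (r, r)/(r) on the Hall–Littlewood side, so g_(2r-j, 1^j) + g_(2r-j+1, 1^(j-1)) = [j = r],
-- a recurrence in j whose solution is the theorem.

{-# OPTIONS --safe #-}
module Submission where

open import Defs

module HookRecurrence where

  open import Data.Bool using (true; false; if_then_else_; _∧_)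
  import Data.Bool.Properties as Bool
  open import Data.Integer using (ℤ; +_; -_; _+_; _-_; _*_; _^_)
  import Data.Integer.Properties as ℤ
  open import Algebra.Properties.CommutativeSemigroup ℤ.+-commutativeSemigroup
    using () renaming (interchange to +-interchange)
  open import Algebra.Properties.CommutativeSemigroup ℤ.*-commutativeSemigroup
    using () renaming (x∙yz≈y∙xz to x*[y*z]≡y*[x*z])
  open import Data.List using (List; []; _∷_; map; concatMap; applyUpTo; upTo; filter; _++_; replicate; reverse; length)
  import Data.List.Properties as List
  open import Data.List.Relation.Unary.All as All using (All; []; _∷_)
  import Data.List.Relation.Unary.All.Properties as All
  open import Data.List.Relation.Unary.Linked as Linked using (Linked; []; [-]; _∷_)
  open import Data.Nat using (ℕ; zero; suc; _∸_; _≤_; _<_; _≥_; _⊓_; _≟_; _<ᵇ_; _≡ᵇ_; z≤n; s≤s; z<s; s<s)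
    renaming (_+_ to _+ℕ_; _*_ to _*ℕ_)
  import Data.Nat.Properties as ℕ
  open import Data.Product using (∃₂; _×_; _,_; proj₁; proj₂)
  open import Data.Sum using (_⊎_; inj₁; inj₂)
  open import Function using (_∘_; id)
  open import Relation.Binary.Definitions using (DecidableEquality; Tri; tri<; tri≈; tri>)
  open import Relation.Binary.PropositionalEquality
  open import Relation.Nullary using (Dec; does; yes; no; ¬_; contradiction; ofʸ; ofⁿ)
  open import Relation.Nullary.Decidable using (dec-true; dec-false; _×-dec_)
  open import Relation.Unary using (Decidable)

  -- Iverson brackets and finite sums

  ⟦_⟧ : ∀ {a} {A : Set a} → Dec A → ℤ
  ⟦ a? ⟧ = if does a? then + 1 else + 0

  ⟦⟧-yes : ∀ {a} {A : Set a} (a? : Dec A) → A → ⟦ a? ⟧ ≡ + 1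
  ⟦⟧-yes a? a rewrite dec-true a? a = refl

  ⟦⟧-no : ∀ {a} {A : Set a} (a? : Dec A) → ¬ A → ⟦ a? ⟧ ≡ + 0
  ⟦⟧-no a? ¬a rewrite dec-false a? ¬a = refl

  ⟦⟧-⇔ : ∀ {a b} {A : Set a} {B : Set b} (a? : Dec A) (b? : Dec B) → (A → B) → (B → A) → ⟦ a? ⟧ ≡ ⟦ b? ⟧
  ⟦⟧-⇔ (yes a) (yes b) _ _ = refl
  ⟦⟧-⇔ (no ¬a) (no ¬b) _ _ = refl
  ⟦⟧-⇔ (yes a) (no ¬b) f _ = contradiction (f a) ¬b
  ⟦⟧-⇔ (no ¬a) (yes b) _ g = contradiction (g b) ¬a

  ⟦⟧-× : ∀ {a b} {A : Set a} {B : Set b} (a? : Dec A) (b? : Dec B) → ⟦ a? ⟧ * ⟦ b? ⟧ ≡ ⟦ a? ×-dec b? ⟧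
  ⟦⟧-× (yes _) (yes _) = refl
  ⟦⟧-× (yes _) (no _)  = refl
  ⟦⟧-× (no _)  _       = refl

  ⟦⟧-guard : ∀ {a} {A : Set a} (a? : Dec A) {x y : ℤ} → (A → x ≡ y) → ⟦ a? ⟧ * x ≡ ⟦ a? ⟧ * y
  ⟦⟧-guard (yes a) x≡y = cong (+ 1 *_) (x≡y a)
  ⟦⟧-guard (no _)  _   = refl

  sum-++ : ∀ xs ys → sumℤ (xs ++ ys) ≡ sumℤ xs + sumℤ ys
  sum-++ []       ys = sym (ℤ.+-identityˡ (sumℤ ys))
  sum-++ (x ∷ xs) ys = trans (cong (_+_ x) (sum-++ xs ys)) (sym (ℤ.+-assoc x (sumℤ xs) (sumℤ ys)))

  module _ {A B : Set} where

    sum-map-map : ∀ (f : B → ℤ) (g : A → B) xs → sumℤ (map f (map g xs)) ≡ sumℤ (map (f ∘ g) xs)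
    sum-map-map f g xs = cong sumℤ (sym (List.map-∘ xs))

    sum-map-concatMap : ∀ (f : B → ℤ) (g : A → List B) xs →
      sumℤ (map f (concatMap g xs)) ≡ sumℤ (map (λ x → sumℤ (map f (g x))) xs)
    sum-map-concatMap f g []       = refl
    sum-map-concatMap f g (x ∷ xs) = begin
      sumℤ (map f (g x ++ concatMap g xs))                ≡⟨ cong sumℤ (List.map-++ f (g x) _) ⟩
      sumℤ (map f (g x) ++ map f (concatMap g xs))        ≡⟨ sum-++ (map f (g x)) _ ⟩
      sumℤ (map f (g x)) + sumℤ (map f (concatMap g xs))  ≡⟨ cong (_+_ (sumℤ (map f (g x)))) (sum-map-concatMap f g xs) ⟩
      sumℤ (map f (g x)) + sumℤ (map (λ x → sumℤ (map f (g x))) xs) ∎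
      where open ≡-Reasoning

  module _ {A : Set} where

    sum-map-filter : ∀ {P : A → Set} (P? : Decidable P) (f : A → ℤ) xs →
      sumℤ (map f (filter P? xs)) ≡ sumℤ (map (λ x → ⟦ P? x ⟧ * f x) xs)
    sum-map-filter P? f [] = refl
    sum-map-filter P? f (x ∷ xs) with does (P? x)
    ... | true  = cong₂ _+_ (sym (ℤ.*-identityˡ (f x))) (sum-map-filter P? f xs)
    ... | false = trans (sum-map-filter P? f xs) (sym (ℤ.+-identityˡ _))

    sum-map-congᴬ : ∀ {f g : A → ℤ} {xs} → All (λ x → f x ≡ g x) xs → sumℤ (map f xs) ≡ sumℤ (map g xs)
    sum-map-congᴬ eqs = cong sumℤ (List.map-cong-local eqs)

    sum-map-cong : ∀ {f g : A → ℤ} xs → (∀ x → f x ≡ g x) → sumℤ (map f xs) ≡ sumℤ (map g xs)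
    sum-map-cong xs eq = cong sumℤ (List.map-cong eq xs)

    sum-map-zero : ∀ {f : A → ℤ} xs → (∀ x → f x ≡ + 0) → sumℤ (map f xs) ≡ + 0
    sum-map-zero []       eq = refl
    sum-map-zero (x ∷ xs) eq = cong₂ _+_ (eq x) (sum-map-zero xs eq)

    sum-map-*ˡ : ∀ c (f : A → ℤ) xs → sumℤ (map (λ x → c * f x) xs) ≡ c * sumℤ (map f xs)
    sum-map-*ˡ c f []       = sym (ℤ.*-zeroʳ c)
    sum-map-*ˡ c f (x ∷ xs) = trans (cong (_+_ (c * f x)) (sum-map-*ˡ c f xs)) (sym (ℤ.*-distribˡ-+ c (f x) _))

    sum-map-+ : ∀ (f g : A → ℤ) xs → sumℤ (map (λ x → f x + g x) xs) ≡ sumℤ (map f xs) + sumℤ (map g xs)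
    sum-map-+ f g []       = refl
    sum-map-+ f g (x ∷ xs) = trans (cong (_+_ (f x + g x)) (sum-map-+ f g xs)) (+-interchange (f x) (g x) _ _)

  -- opaque, so that ∑ (suc n) f does not unfold and f stays inferable from a goal
  opaque
    ∑ : ℕ → (ℕ → ℤ) → ℤ
    ∑ zero    f = + 0
    ∑ (suc n) f = f 0 + ∑ n (f ∘ suc)

    syntax ∑ n (λ i → e) = ∑[ i < n ] e

    ∏ : ℕ → (ℕ → ℤ) → ℤ
    ∏ zero    f = + 1
    ∏ (suc n) f = f 0 * ∏ n (f ∘ suc)

    syntax ∏ n (λ i → e) = ∏[ i < n ] e

    ∑-suc : ∀ n (f : ℕ → ℤ) → ∑ (suc n) f ≡ f 0 + ∑ n (f ∘ suc)
    ∑-suc n f = refl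

    ∑-one : ∀ (f : ℕ → ℤ) → ∑ 1 f ≡ f 0
    ∑-one f = ℤ.+-identityʳ (f 0)

    ∑-cong : ∀ n {f g : ℕ → ℤ} → (∀ i → i < n → f i ≡ g i) → ∑ n f ≡ ∑ n g
    ∑-cong zero    eq = refl
    ∑-cong (suc n) eq = cong₂ _+_ (eq 0 z<s) (∑-cong n (λ i i<n → eq (suc i) (s<s i<n)))

    ∑-zero : ∀ n {f : ℕ → ℤ} → (∀ i → i < n → f i ≡ + 0) → ∑ n f ≡ + 0
    ∑-zero zero    eq = refl
    ∑-zero (suc n) eq = cong₂ _+_ (eq 0 z<s) (∑-zero n (λ i i<n → eq (suc i) (s<s i<n)))

    ∑-+ : ∀ n (f g : ℕ → ℤ) → ∑[ i < n ] (f i + g i) ≡ ∑ n f + ∑ n g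
    ∑-+ zero    f g = refl
    ∑-+ (suc n) f g = trans (cong (_+_ (f 0 + g 0)) (∑-+ n (f ∘ suc) (g ∘ suc))) (+-interchange (f 0) (g 0) _ _)

    ∑-*ˡ : ∀ n c (f : ℕ → ℤ) → ∑[ i < n ] (c * f i) ≡ c * ∑ n f
    ∑-*ˡ zero    c f = sym (ℤ.*-zeroʳ c)
    ∑-*ˡ (suc n) c f = trans (cong (_+_ (c * f 0)) (∑-*ˡ n c (f ∘ suc))) (sym (ℤ.*-distribˡ-+ c (f 0) _))

    ∑-neg : ∀ n (f : ℕ → ℤ) → ∑[ i < n ] (- f i) ≡ - ∑ n f
    ∑-neg zero    f = refl
    ∑-neg (suc n) f = trans (cong (_+_ (- f 0)) (∑-neg n (f ∘ suc))) (sym (ℤ.neg-distrib-+ (f 0) _))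

    ∑-single : ∀ {n} k {f : ℕ → ℤ} → k < n → (∀ i → i < n → i ≢ k → f i ≡ + 0) → ∑ n f ≡ f k
    ∑-single {suc n} zero    {f} _ off =
      trans (cong (_+_ (f 0)) (∑-zero n (λ i i<n → off (suc i) (s<s i<n) λ ()))) (ℤ.+-identityʳ (f 0))
    ∑-single {suc n} (suc k) {f} (s<s k<n) off =
      trans (cong₂ _+_ (off 0 z<s λ ()) (∑-single k k<n (λ i i<n i≢k → off (suc i) (s<s i<n) (i≢k ∘ ℕ.suc-injective))))
            (ℤ.+-identityˡ (f (suc k)))

    ∑-comm : ∀ m n (f : ℕ → ℕ → ℤ) → ∑[ i < m ] ∑ n (f i) ≡ ∑[ k < n ] ∑[ i < m ] f i k
    ∑-comm zero    n f = sym (∑-zero n (λ _ _ → refl))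
    ∑-comm (suc m) n f =
      trans (cong (_+_ (∑ n (f 0))) (∑-comm m n (f ∘ suc))) (sym (∑-+ n (f 0) (λ k → ∑[ i < m ] f (suc i) k)))

    ∏-one : ∀ n {f : ℕ → ℤ} → (∀ i → i < n → f i ≡ + 1) → ∏ n f ≡ + 1
    ∏-one zero    eq = refl
    ∏-one (suc n) eq = cong₂ _*_ (eq 0 z<s) (∏-one n (λ i i<n → eq (suc i) (s<s i<n)))

    ∏-zero : ∀ {n} k {f : ℕ → ℤ} → k < n → f k ≡ + 0 → ∏ n f ≡ + 0
    ∏-zero {suc n} zero    {f} _         f₀≡0 = cong (_* ∏ n (f ∘ suc)) f₀≡0
    ∏-zero {suc n} (suc k) {f} (s<s k<n) fₖ≡0 = trans (cong (f 0 *_) (∏-zero k k<n fₖ≡0)) (ℤ.*-zeroʳ (f 0))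

    ∏-single : ∀ {n} k {f : ℕ → ℤ} → k < n → (∀ i → i < n → i ≢ k → f i ≡ + 1) → ∏ n f ≡ f k
    ∏-single {suc n} zero    {f} _ off =
      trans (cong (f 0 *_) (∏-one n (λ i i<n → off (suc i) (s<s i<n) λ ()))) (ℤ.*-identityʳ (f 0))
    ∏-single {suc n} (suc k) {f} (s<s k<n) off =
      trans (cong₂ _*_ (off 0 z<s λ ()) (∏-single k k<n (λ i i<n i≢k → off (suc i) (s<s i<n) (i≢k ∘ ℕ.suc-injective))))
            (ℤ.*-identityˡ (f (suc k)))

    sum-map-applyUpTo : ∀ {A : Set} (f : A → ℤ) (g : ℕ → A) n → sumℤ (map f (applyUpTo g n)) ≡ ∑ n (f ∘ g)
    sum-map-applyUpTo f g zero    = refl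
    sum-map-applyUpTo f g (suc n) = cong (_+_ (f (g 0))) (sum-map-applyUpTo f (g ∘ suc) n)

    sum-map-range : ∀ (f : ℕ → ℤ) a b → sumℤ (map f (range a b)) ≡ ∑[ i < suc b ∸ a ] f (a +ℕ i)
    sum-map-range f a b = trans (sum-map-map f (a +ℕ_) (upTo (suc b ∸ a))) (sum-map-applyUpTo (f ∘ (a +ℕ_)) id (suc b ∸ a))

    prod-map-range : ∀ (f : ℕ → ℤ) a b → prodℤ (map f (range a b)) ≡ ∏[ i < suc b ∸ a ] f (a +ℕ i)
    prod-map-range f a b = go (suc b ∸ a) id
      where
      go : ∀ n g → prodℤ (map f (map (a +ℕ_) (applyUpTo g n))) ≡ ∏[ i < n ] f (a +ℕ g i)
      go zero    g = refl
      go (suc n) g = cong (f (a +ℕ g 0) *_) (go n (g ∘ suc))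

  minus1^-suc : ∀ n → minus1 ^ suc n ≡ - minus1 ^ n
  minus1^-suc n = ℤ.-1*i≡-i (minus1 ^ n)

  minus1^-even : ∀ n → minus1 ^ (n +ℕ n) ≡ + 1
  minus1^-even zero    = refl
  minus1^-even (suc n) = begin
    minus1 ^ suc (n +ℕ suc n)   ≡⟨ cong (λ k → minus1 ^ suc k) (ℕ.+-suc n n) ⟩
    minus1 ^ suc (suc (n +ℕ n)) ≡⟨ trans (minus1^-suc (suc (n +ℕ n))) (cong -_ (minus1^-suc (n +ℕ n))) ⟩
    - - minus1 ^ (n +ℕ n)       ≡⟨ ℤ.neg-involutive _ ⟩
    minus1 ^ (n +ℕ n)           ≡⟨ minus1^-even n ⟩
    + 1                         ∎
    where open ≡-Reasoning

  minus1^-∸ : ∀ {u K} → u ≤ K → minus1 ^ (K ∸ u) ≡ minus1 ^ K * minus1 ^ u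
  minus1^-∸ {u} {K} u≤K = begin
    minus1 ^ (K ∸ u)
      ≡⟨ sym (ℤ.*-identityʳ _) ⟩
    minus1 ^ (K ∸ u) * + 1
      ≡⟨ cong (minus1 ^ (K ∸ u) *_) (sym (trans (sym (ℤ.^-distribˡ-+-* minus1 u u)) (minus1^-even u))) ⟩
    minus1 ^ (K ∸ u) * (minus1 ^ u * minus1 ^ u)
      ≡⟨ sym (ℤ.*-assoc (minus1 ^ (K ∸ u)) _ _) ⟩
    minus1 ^ (K ∸ u) * minus1 ^ u * minus1 ^ u
      ≡⟨ cong (_* minus1 ^ u) (sym (ℤ.^-distribˡ-+-* minus1 (K ∸ u) u)) ⟩
    minus1 ^ (K ∸ u +ℕ u) * minus1 ^ u
      ≡⟨ cong (λ k → minus1 ^ k * minus1 ^ u) (ℕ.m∸n+n≡m u≤K) ⟩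
    minus1 ^ K * minus1 ^ u ∎
    where open ≡-Reasoning

  ∑-sign-shift : ∀ n (f : ℕ → ℤ) → ∑[ i < n ] (minus1 ^ suc i * f i) ≡ - ∑[ i < n ] (minus1 ^ i * f i)
  ∑-sign-shift n f = trans (∑-cong n λ i _ → trans (cong (_* f i) (minus1^-suc i)) (sym (ℤ.neg-distribˡ-* (minus1 ^ i) (f i))))
                           (∑-neg n (λ i → minus1 ^ i * f i))

  ∑-sign-twos-one : ∀ b (V : ℕ → ℤ) → (∀ i → i < b → V i ≡ + 2) → V b ≡ + 1 →
    ∑[ i < suc b ] (minus1 ^ i * V i) ≡ + 1
  ∑-sign-twos-one zero    V _    V₀≡1 = trans (∑-one (λ i → minus1 ^ i * V i)) (trans (ℤ.*-identityˡ (V 0)) V₀≡1)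
  ∑-sign-twos-one (suc b) V twos Vb≡1 = begin
    ∑[ i < suc (suc b) ] (minus1 ^ i * V i)
      ≡⟨ ∑-suc (suc b) _ ⟩
    + 1 * V 0 + ∑[ i < suc b ] (minus1 ^ suc i * V (suc i))
      ≡⟨ cong₂ _+_ (trans (ℤ.*-identityˡ (V 0)) (twos 0 z<s)) (∑-sign-shift (suc b) (V ∘ suc)) ⟩
    + 2 - ∑[ i < suc b ] (minus1 ^ i * V (suc i))
      ≡⟨ cong (λ x → + 2 - x) (∑-sign-twos-one b (V ∘ suc) (λ i i<b → twos (suc i) (s<s i<b)) Vb≡1) ⟩
    + 1 ∎
    where open ≡-Reasoning

  ∑-sign-one-twos-one : ∀ D (V : ℕ → ℤ) →
    V 0 ≡ + 1 → (∀ u → 0 < u → u ≤ D → V u ≡ + 2) → V (suc D) ≡ + 1 →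
    ∑[ u < suc (suc D) ] (minus1 ^ u * V u) ≡ + 0
  ∑-sign-one-twos-one D V V₀≡1 twos V₁₊D≡1 = begin
    ∑[ u < suc (suc D) ] (minus1 ^ u * V u)
      ≡⟨ ∑-suc (suc D) _ ⟩
    + 1 * V 0 + ∑[ u < suc D ] (minus1 ^ suc u * V (suc u))
      ≡⟨ cong₂ _+_ (trans (ℤ.*-identityˡ (V 0)) V₀≡1) (∑-sign-shift (suc D) (V ∘ suc)) ⟩
    + 1 - ∑[ u < suc D ] (minus1 ^ u * V (suc u))
      ≡⟨ cong (λ x → + 1 - x) (∑-sign-twos-one D (V ∘ suc) (λ u u<D → twos (suc u) z<s u<D) V₁₊D≡1) ⟩
    + 0 ∎
    where open ≡-Reasoning

  ∑-sign-pick : ∀ b q → q ≤ b → ∑[ i < suc b ] (minus1 ^ i * ⟦ b ∸ i ≟ q ⟧) ≡ minus1 ^ (b ∸ q)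
  ∑-sign-pick b q q≤b = begin
    ∑[ i < suc b ] (minus1 ^ i * ⟦ b ∸ i ≟ q ⟧)
      ≡⟨ ∑-single (b ∸ q) (s≤s (ℕ.m∸n≤m b q)) off ⟩
    minus1 ^ (b ∸ q) * ⟦ b ∸ (b ∸ q) ≟ q ⟧
      ≡⟨ cong (minus1 ^ (b ∸ q) *_) (⟦⟧-yes (b ∸ (b ∸ q) ≟ q) (ℕ.m∸[m∸n]≡n q≤b)) ⟩
    minus1 ^ (b ∸ q) * + 1
      ≡⟨ ℤ.*-identityʳ _ ⟩
    minus1 ^ (b ∸ q) ∎
    where
    open ≡-Reasoning
    off : ∀ i → i < suc b → i ≢ b ∸ q → minus1 ^ i * ⟦ b ∸ i ≟ q ⟧ ≡ + 0
    off i (s≤s i≤b) i≢b∸q = trans (cong (minus1 ^ i *_) (⟦⟧-no (b ∸ i ≟ q) λ b∸i≡q →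
      i≢b∸q (trans (sym (ℕ.m∸[m∸n]≡n i≤b)) (cong (b ∸_) b∸i≡q)))) (ℤ.*-zeroʳ (minus1 ^ i))

  ∑-sign-none : ∀ b q → b < q → ∑[ i < suc b ] (minus1 ^ i * ⟦ b ∸ i ≟ q ⟧) ≡ + 0
  ∑-sign-none b q b<q = ∑-zero (suc b) λ i _ → trans (cong (minus1 ^ i *_) (⟦⟧-no (b ∸ i ≟ q) λ b∸i≡q →
    ℕ.<⇒≱ b<q (subst (_≤ b) b∸i≡q (ℕ.m∸n≤m b i)))) (ℤ.*-zeroʳ (minus1 ^ i))

  ∑-pick : ∀ {n} k (f : ℕ → ℤ) → k < n → ∑[ y < n ] (f y * ⟦ k ≟ y ⟧) ≡ f k
  ∑-pick k f k<n = trans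
    (∑-single k k<n λ y _ y≢k → trans (cong (f y *_) (⟦⟧-no (k ≟ y) (y≢k ∘ sym))) (ℤ.*-zeroʳ (f y)))
    (trans (cong (f k *_) (⟦⟧-yes (k ≟ k) refl)) (ℤ.*-identityʳ (f k)))

  prev : (ℕ → ℤ) → ℕ → ℤ
  prev a zero    = + 0
  prev a (suc j) = a j

  prev-zero : ∀ j (a : ℕ → ℤ) → (∀ k → suc k ≡ j → a k ≡ + 0) → prev a j ≡ + 0
  prev-zero zero    a _    = refl
  prev-zero (suc j) a vanish = vanish j refl

  -- Interlacing sequences and horizontal strips

  Positive : List ℕ → Set
  Positive = All (1 ≤_)

  Decreasing : List ℕ → Set
  Decreasing = Linked _≥_

  +-<-∸ : ∀ {i} a n → i < n ∸ a → a +ℕ i < n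
  +-<-∸ zero    n       i<n   = i<n
  +-<-∸ (suc a) (suc n) i<n-a = s≤s (+-<-∸ a n i<n-a)

  ∸-suc : ∀ {j n} → j < n → n ∸ j ≡ suc (n ∸ suc j)
  ∸-suc {j} {suc n} (s≤s j≤n) = ℕ.+-∸-assoc 1 j≤n

  range-bounds : ∀ a b → All (λ k → a ≤ k × k ≤ b) (range a b)
  range-bounds a b = All.map⁺ (All.applyUpTo⁺₁ id (suc b ∸ a) λ {i} i<b+1-a →
    ℕ.m≤m+n a i , ℕ.≤-pred (+-<-∸ a (suc b) i<b+1-a))

  decreasing-cons : ∀ {k ρ} → headℕ ρ ≤ k → Decreasing ρ → Decreasing (k ∷ ρ)
  decreasing-cons {ρ = []}    _    _  = [-]
  decreasing-cons {ρ = _ ∷ _} ρ₁≤k ρ↓ = ρ₁≤k ∷ ρ↓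

  interlace-decreasing : ∀ μ → All (λ ρ → Decreasing ρ × headℕ ρ ≤ headℕ μ) (interlace μ)
  interlace-decreasing []            = ([] , z≤n) ∷ []
  interlace-decreasing (m ∷ [])      = All.map⁺ (All.map (λ (_ , k≤m) → [-] , k≤m) (range-bounds 0 m))
  interlace-decreasing (m ∷ m′ ∷ ν) =
    All.concat⁺ (All.map⁺ (All.map (extend (interlace-decreasing (m′ ∷ ν))) (range-bounds m′ m)))
    where
    extend : All (λ ρ → Decreasing ρ × headℕ ρ ≤ m′) (interlace (m′ ∷ ν)) → ∀ {k} → m′ ≤ k × k ≤ m →
             All (λ ρ → Decreasing ρ × headℕ ρ ≤ m) (map (k ∷_) (interlace (m′ ∷ ν)))
    extend tails (m′≤k , k≤m) =
      All.map⁺ (All.map (λ (ρ↓ , ρ₁≤m′) → decreasing-cons (ℕ.≤-trans ρ₁≤m′ m′≤k) ρ↓ , k≤m) tails)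

  stripZ-head : ∀ ρ {y ys} → stripZ ρ ≡ y ∷ ys → headℕ ρ ≡ y
  stripZ-head (x ∷ ρ) eq with stripZ ρ
  stripZ-head (suc x ∷ ρ) refl | []    = refl
  stripZ-head (x ∷ ρ)     refl | _ ∷ _ = refl

  stripZ-positive : ∀ {ρ} → Decreasing ρ → Positive (stripZ ρ)
  stripZ-positive {[]}    _  = []
  stripZ-positive {x ∷ ρ} ρ↓ with stripZ ρ in eq
  stripZ-positive {zero  ∷ ρ} _ | [] = []
  stripZ-positive {suc x ∷ ρ} _ | [] = s≤s z≤n ∷ []
  stripZ-positive {x ∷ ρ@(x′ ∷ _)} (x′≤x ∷ ρ↓) | y ∷ ys with stripZ-positive ρ↓
  ... | positive rewrite eq = ℕ.≤-trans (All.head positive) (subst (_≤ x) (stripZ-head ρ eq) x′≤x) ∷ positive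

  hstrips-positive : ∀ μ a → All Positive (hstrips μ a)
  hstrips-positive μ a = All.filter⁺ _ (All.map⁺ (All.map (stripZ-positive ∘ proj₁) (interlace-decreasing μ)))

  sum-hstrips : ∀ μ a (G : List ℕ → ℤ) →
    sumℤ (map G (hstrips μ a))
      ≡ sumℤ (map (λ ρ → ⟦ sumℕ μ ≟ a +ℕ sumℕ (stripZ ρ) ⟧ * G (stripZ ρ)) (interlace μ))
  sum-hstrips μ a G = trans (sum-map-filter _ G (map stripZ (interlace μ))) (sum-map-map _ stripZ (interlace μ))

  sum-interlace-row : ∀ p (G : List ℕ → ℤ) → sumℤ (map G (interlace (p ∷ []))) ≡ ∑[ y < suc p ] G (y ∷ [])
  sum-interlace-row p G = trans (sum-map-map G (_∷ []) (range 0 p)) (sum-map-range (G ∘ (_∷ [])) 0 p)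

  sum-interlace-cons : ∀ p q ν (G : List ℕ → ℤ) →
    sumℤ (map G (interlace (p ∷ q ∷ ν)))
      ≡ ∑[ u < suc p ∸ q ] sumℤ (map (λ ρ → G (q +ℕ u ∷ ρ)) (interlace (q ∷ ν)))
  sum-interlace-cons p q ν G = begin
    sumℤ (map G (concatMap (λ k → map (k ∷_) (interlace (q ∷ ν))) (range q p)))
      ≡⟨ sum-map-concatMap G (λ k → map (k ∷_) (interlace (q ∷ ν))) (range q p) ⟩
    sumℤ (map (λ k → sumℤ (map G (map (k ∷_) (interlace (q ∷ ν))))) (range q p))
      ≡⟨ sum-map-range _ q p ⟩
    ∑[ u < suc p ∸ q ] sumℤ (map G (map (q +ℕ u ∷_) (interlace (q ∷ ν))))
      ≡⟨ ∑-cong (suc p ∸ q) (λ u _ → sum-map-map G (q +ℕ u ∷_) (interlace (q ∷ ν))) ⟩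
    ∑[ u < suc p ∸ q ] sumℤ (map (λ ρ → G (q +ℕ u ∷ ρ)) (interlace (q ∷ ν))) ∎
    where open ≡-Reasoning

  sum-interlace-twoRow : ∀ p q (G : List ℕ → ℤ) →
    sumℤ (map G (interlace (p ∷ q ∷ []))) ≡ ∑[ u < suc p ∸ q ] ∑[ y < suc q ] G (q +ℕ u ∷ y ∷ [])
  sum-interlace-twoRow p q G =
    trans (sum-interlace-cons p q [] G) (∑-cong (suc p ∸ q) (λ u _ → sum-interlace-row q (λ ρ → G (q +ℕ u ∷ ρ))))

  -- The pairing with e_b

  -- pairE f b F = Σ (-1)^(b - ℓ(c)) F c over the compositions c of b with at most f parts.  Since
  -- e_b = Σ_c (-1)^(b - ℓ(c)) h_c, this is ⟨s, e_b⟩ when F c is the coefficient of x^c in s and f ≥ b.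
  pairE : ℕ → ℕ → (List ℕ → ℤ) → ℤ
  pairE _       zero    F = F []
  pairE zero    (suc b) F = + 0
  pairE (suc f) (suc b) F = ∑[ i < suc b ] (minus1 ^ i * pairE f (b ∸ i) (λ δ → F (suc i ∷ δ)))

  pairE-cong : ∀ f b {F G : List ℕ → ℤ} → (∀ δ → F δ ≡ G δ) → pairE f b F ≡ pairE f b G
  pairE-cong f       zero    eq = eq []
  pairE-cong zero    (suc b) eq = refl
  pairE-cong (suc f) (suc b) eq =
    ∑-cong (suc b) (λ i _ → cong (minus1 ^ i *_) (pairE-cong f (b ∸ i) (λ δ → eq (suc i ∷ δ))))

  pairE-zero : ∀ f b {F : List ℕ → ℤ} → (∀ δ → F δ ≡ + 0) → pairE f b F ≡ + 0
  pairE-zero f       zero    eq = eq []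
  pairE-zero zero    (suc b) eq = refl
  pairE-zero (suc f) (suc b) eq =
    ∑-zero (suc b) (λ i _ → trans (cong (minus1 ^ i *_) (pairE-zero f (b ∸ i) (λ δ → eq (suc i ∷ δ))))
                                  (ℤ.*-zeroʳ (minus1 ^ i)))

  pairE-+ : ∀ f b (F G : List ℕ → ℤ) → pairE f b (λ δ → F δ + G δ) ≡ pairE f b F + pairE f b G
  pairE-+ f       zero    F G = refl
  pairE-+ zero    (suc b) F G = refl
  pairE-+ (suc f) (suc b) F G = begin
    ∑[ i < suc b ] (minus1 ^ i * pairE f (b ∸ i) (λ δ → F (suc i ∷ δ) + G (suc i ∷ δ)))
      ≡⟨ ∑-cong (suc b) (λ i _ → trans (cong (minus1 ^ i *_) (pairE-+ f (b ∸ i) _ _)) (ℤ.*-distribˡ-+ (minus1 ^ i) _ _)) ⟩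
    ∑[ i < suc b ] (minus1 ^ i * pairE f (b ∸ i) (λ δ → F (suc i ∷ δ)) + minus1 ^ i * pairE f (b ∸ i) (λ δ → G (suc i ∷ δ)))
      ≡⟨ ∑-+ (suc b) _ _ ⟩
    pairE (suc f) (suc b) F + pairE (suc f) (suc b) G ∎
    where open ≡-Reasoning

  pairE-*ˡ : ∀ f b c (F : List ℕ → ℤ) → pairE f b (λ δ → c * F δ) ≡ c * pairE f b F
  pairE-*ˡ f       zero    c F = refl
  pairE-*ˡ zero    (suc b) c F = sym (ℤ.*-zeroʳ c)
  pairE-*ˡ (suc f) (suc b) c F = begin
    ∑[ i < suc b ] (minus1 ^ i * pairE f (b ∸ i) (λ δ → c * F (suc i ∷ δ)))
      ≡⟨ ∑-cong (suc b) (λ i _ → trans (cong (minus1 ^ i *_) (pairE-*ˡ f (b ∸ i) c _)) (x*[y*z]≡y*[x*z] (minus1 ^ i) c _)) ⟩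
    ∑[ i < suc b ] (c * (minus1 ^ i * pairE f (b ∸ i) (λ δ → F (suc i ∷ δ))))
      ≡⟨ ∑-*ˡ (suc b) c _ ⟩
    c * pairE (suc f) (suc b) F ∎
    where
    open ≡-Reasoning

  pairE-sum : ∀ {A : Set} f b (c : A → ℤ) (G : A → List ℕ → ℤ) xs →
    pairE f b (λ δ → sumℤ (map (λ x → c x * G x δ) xs)) ≡ sumℤ (map (λ x → c x * pairE f b (G x)) xs)
  pairE-sum f b c G []       = pairE-zero f b (λ _ → refl)
  pairE-sum f b c G (x ∷ xs) =
    trans (pairE-+ f b _ _) (cong₂ _+_ (pairE-*ˡ f b (c x) (G x)) (pairE-sum f b c G xs))

  pairE-chainSum-∷ : ∀ w f b ν a →
    pairE f b (λ δ → chainSum w ν (a ∷ δ)) ≡ sumℤ (map (λ ρ → w ν ρ * pairE f b (chainSum w ρ)) (hstrips ν a))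
  pairE-chainSum-∷ w f b ν a = pairE-sum f b (w ν) (chainSum w) (hstrips ν a)

  -- Schur functions

  infix 4 _≟ₗ_

  _≟ₗ_ : DecidableEquality (List ℕ)
  _≟ₗ_ = List.≡-dec _≟_

  ⟦∷≟ₗ∷⟧ : ∀ x y xs ys → ⟦ x ∷ xs ≟ₗ y ∷ ys ⟧ ≡ ⟦ x ≟ y ⟧ * ⟦ xs ≟ₗ ys ⟧
  ⟦∷≟ₗ∷⟧ x y xs ys = sym (⟦⟧-× (x ≟ y) (xs ≟ₗ ys))

  hookShape : ℕ → ℕ → List ℕ
  hookShape p q = suc p ∷ replicate q 1

  sumℕ-replicate : ∀ q → sumℕ (replicate q 1) ≡ q
  sumℕ-replicate zero    = refl
  sumℕ-replicate (suc q) = cong suc (sumℕ-replicate q)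

  sumℕ-hookShape : ∀ p q → sumℕ (hookShape p q) ≡ suc p +ℕ q
  sumℕ-hookShape p q = cong (suc p +ℕ_) (sumℕ-replicate q)

  stripZ-suc : ∀ k ρ → stripZ (suc k ∷ ρ) ≡ suc k ∷ stripZ ρ
  stripZ-suc k ρ with stripZ ρ
  ... | []    = refl
  ... | _ ∷ _ = refl

  unitWeight : List ℕ → List ℕ → ℤ
  unitWeight _ _ = + 1

  -- [ν/(1^m) is a horizontal strip]
  columnCount : List ℕ → ℕ → ℤ
  columnCount ν m = sumℤ (map (λ ρ → ⟦ stripZ ρ ≟ₗ replicate m 1 ⟧) (interlace ν))

  columnCount-row : ∀ p m → columnCount (suc p ∷ []) m ≡ ⟦ m ≟ 0 ⟧ + ⟦ m ≟ 1 ⟧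
  columnCount-row p m = trans (sum-interlace-row (suc p) (λ ρ → ⟦ stripZ ρ ≟ₗ replicate m 1 ⟧))
                              (trans (∑-suc (suc p) _) (lengths m))
    where
    lengths : ∀ m → ⟦ [] ≟ₗ replicate m 1 ⟧ + ∑[ y < suc p ] ⟦ suc y ∷ [] ≟ₗ replicate m 1 ⟧
                      ≡ ⟦ m ≟ 0 ⟧ + ⟦ m ≟ 1 ⟧
    lengths zero          = cong (_+_ (+ 1)) (∑-zero (suc p) (λ _ _ → refl))
    lengths (suc zero)    = trans (ℤ.+-identityˡ _) (∑-single 0 z<s λ where
      zero    _ 0≢0 → contradiction refl 0≢0
      (suc y) _ _   → refl)
    lengths (suc (suc m)) = cong (_+_ (+ 0)) (∑-zero (suc p) λ where
      zero    _ → refl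
      (suc y) _ → refl)

  columnCount-cons-zero : ∀ p q ν → columnCount (p ∷ suc q ∷ ν) 0 ≡ + 0
  columnCount-cons-zero p q ν = trans (sum-interlace-cons p (suc q) ν _)
    (∑-zero (suc p ∸ suc q) (λ u _ →
      sum-map-zero (interlace (suc q ∷ ν)) (λ ρ → cong (λ σ → ⟦ σ ≟ₗ [] ⟧) (stripZ-suc (q +ℕ u) ρ))))

  columnCount-cons-suc : ∀ p q ν m → 1 ≤ p →
    columnCount (p ∷ suc q ∷ ν) (suc m) ≡ ⟦ q ≟ 0 ⟧ * columnCount (suc q ∷ ν) m
  columnCount-cons-suc p q ν m 1≤p = begin
    columnCount (p ∷ suc q ∷ ν) (suc m)
      ≡⟨ sum-interlace-cons p (suc q) ν _ ⟩
    ∑[ u < p ∸ q ] sumℤ (map (λ ρ → ⟦ stripZ (suc q +ℕ u ∷ ρ) ≟ₗ replicate (suc m) 1 ⟧) (interlace (suc q ∷ ν)))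
      ≡⟨ ∑-cong (p ∸ q) (λ u _ → trans (sum-map-cong (interlace (suc q ∷ ν)) (λ ρ →
           trans (cong (λ σ → ⟦ σ ≟ₗ replicate (suc m) 1 ⟧) (stripZ-suc (q +ℕ u) ρ))
                 (⟦∷≟ₗ∷⟧ (suc (q +ℕ u)) 1 (stripZ ρ) (replicate m 1))))
           (sum-map-*ˡ ⟦ q +ℕ u ≟ 0 ⟧ (λ ρ → ⟦ stripZ ρ ≟ₗ replicate m 1 ⟧) (interlace (suc q ∷ ν)))) ⟩
    ∑[ u < p ∸ q ] (⟦ q +ℕ u ≟ 0 ⟧ * columnCount (suc q ∷ ν) m)
      ≡⟨ first-only q ⟩
    ⟦ q ≟ 0 ⟧ * columnCount (suc q ∷ ν) m ∎
    where
    open ≡-Reasoning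
    first-only : ∀ q → ∑[ u < p ∸ q ] (⟦ q +ℕ u ≟ 0 ⟧ * columnCount (suc q ∷ ν) m)
                         ≡ ⟦ q ≟ 0 ⟧ * columnCount (suc q ∷ ν) m
    first-only zero    = ∑-single 0 1≤p λ where
      zero    _ 0≢0 → contradiction refl 0≢0
      (suc u) _ _   → refl
    first-only (suc q) = ∑-zero (p ∸ suc q) (λ _ _ → refl)

  columnCount-hook : ∀ p q m → columnCount (hookShape p q) m ≡ ⟦ m ≟ q ⟧ + ⟦ m ≟ suc q ⟧
  columnCount-hook p zero    m       = columnCount-row p m
  columnCount-hook p (suc q) zero    = columnCount-cons-zero (suc p) 0 (replicate q 1)
  columnCount-hook p (suc q) (suc m) =
    trans (columnCount-cons-suc (suc p) 0 (replicate q 1) m (s≤s z≤n))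
          (trans (ℤ.*-identityˡ _) (columnCount-hook 0 q m))

  columnCount-hook-leg : ∀ p q → columnCount (hookShape p q) q ≡ + 1
  columnCount-hook-leg p q =
    trans (columnCount-hook p q q) (cong₂ _+_ (⟦⟧-yes (q ≟ q) refl) (⟦⟧-no (q ≟ suc q) (ℕ.<⇒≢ (ℕ.n<1+n q))))

  columnCount-classify : ∀ {ν} → Positive ν →
    ν ≡ [] ⊎ (∃₂ λ p q → ν ≡ hookShape p q) ⊎ (∀ m → columnCount ν m ≡ + 0)
  columnCount-classify {[]}                          _              = inj₁ refl
  columnCount-classify {suc p ∷ []}                  _              = inj₂ (inj₁ (p , 0 , refl))
  columnCount-classify {suc p ∷ suc zero ∷ ν}        (_ ∷ ν⁺) with columnCount-classify ν⁺
  ... | inj₂ (inj₁ (_ , q , refl)) = inj₂ (inj₁ (p , suc q , refl))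
  ... | inj₂ (inj₂ none)           = inj₂ (inj₂ λ where
    zero    → columnCount-cons-zero (suc p) 0 ν
    (suc m) → trans (columnCount-cons-suc (suc p) 0 ν m (s≤s z≤n)) (cong (+ 1 *_) (none m)))
  columnCount-classify {suc p ∷ suc (suc s) ∷ ν}     _              = inj₂ (inj₂ λ where
    zero    → columnCount-cons-zero (suc p) (suc s) ν
    (suc m) → columnCount-cons-suc (suc p) (suc s) ν m (s≤s z≤n))
  columnCount-classify {zero ∷ _}                    (() ∷ _)
  columnCount-classify {suc _ ∷ zero ∷ _}            (_ ∷ () ∷ _)

  alternating-columnCount-hook : ∀ p q →
    ∑[ i < suc (p +ℕ q) ] (minus1 ^ i * columnCount (hookShape p q) (p +ℕ q ∸ i))
      ≡ ⟦ hookShape p q ≟ₗ replicate (suc (p +ℕ q)) 1 ⟧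
  alternating-columnCount-hook p q = begin
    ∑[ i < suc b ] (minus1 ^ i * columnCount (hookShape p q) (b ∸ i))
      ≡⟨ ∑-cong (suc b) (λ i _ → trans (cong (minus1 ^ i *_) (columnCount-hook p q (b ∸ i)))
                                       (ℤ.*-distribˡ-+ (minus1 ^ i) _ _)) ⟩
    ∑[ i < suc b ] (minus1 ^ i * ⟦ b ∸ i ≟ q ⟧ + minus1 ^ i * ⟦ b ∸ i ≟ suc q ⟧)
      ≡⟨ ∑-+ (suc b) _ _ ⟩
    ∑[ i < suc b ] (minus1 ^ i * ⟦ b ∸ i ≟ q ⟧) + ∑[ i < suc b ] (minus1 ^ i * ⟦ b ∸ i ≟ suc q ⟧)
      ≡⟨ cong (_+ ∑[ i < suc b ] (minus1 ^ i * ⟦ b ∸ i ≟ suc q ⟧)) (∑-sign-pick b q (ℕ.m≤n+m q p)) ⟩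
    minus1 ^ (b ∸ q) + ∑[ i < suc b ] (minus1 ^ i * ⟦ b ∸ i ≟ suc q ⟧)
      ≡⟨ by-arm p ⟩
    ⟦ hookShape p q ≟ₗ replicate (suc b) 1 ⟧ ∎
    where
    open ≡-Reasoning
    b : ℕ
    b = p +ℕ q
    by-arm : ∀ p → minus1 ^ (p +ℕ q ∸ q) + ∑[ i < suc (p +ℕ q) ] (minus1 ^ i * ⟦ p +ℕ q ∸ i ≟ suc q ⟧)
                     ≡ ⟦ hookShape p q ≟ₗ replicate (suc (p +ℕ q)) 1 ⟧
    by-arm zero    = trans (cong₂ _+_ (cong (minus1 ^_) (ℕ.n∸n≡0 q)) (∑-sign-none q (suc q) (ℕ.n<1+n q)))
                           (sym (⟦⟧-yes (hookShape 0 q ≟ₗ replicate (suc q) 1) refl))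
    by-arm (suc p) = begin
      minus1 ^ (suc p +ℕ q ∸ q) + ∑[ i < suc (suc p +ℕ q) ] (minus1 ^ i * ⟦ suc p +ℕ q ∸ i ≟ suc q ⟧)
        ≡⟨ cong₂ _+_ (cong (minus1 ^_) (ℕ.m+n∸n≡m (suc p) q))
                     (∑-sign-pick (suc p +ℕ q) (suc q) (s≤s (ℕ.m≤n+m q p))) ⟩
      minus1 ^ suc p + minus1 ^ (p +ℕ q ∸ q)
        ≡⟨ cong₂ _+_ (minus1^-suc p) (cong (minus1 ^_) (ℕ.m+n∸n≡m p q)) ⟩
      - minus1 ^ p + minus1 ^ p
        ≡⟨ ℤ.+-inverseˡ (minus1 ^ p) ⟩
      + 0 ∎

  alternating-columnCount : ∀ {ν} b → Positive ν → sumℕ ν ≡ suc b →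
    ∑[ i < suc b ] (minus1 ^ i * columnCount ν (b ∸ i)) ≡ ⟦ ν ≟ₗ replicate (suc b) 1 ⟧
  alternating-columnCount {ν} b ν⁺ |ν|≡1+b with columnCount-classify ν⁺
  ... | inj₁ refl = contradiction |ν|≡1+b λ ()
  ... | inj₂ (inj₁ (p , q , refl))
    with refl ← ℕ.suc-injective (trans (sym (sumℕ-hookShape p q)) |ν|≡1+b) = alternating-columnCount-hook p q
  ... | inj₂ (inj₂ none) =
    trans (∑-zero (suc b) λ i _ → trans (cong (minus1 ^ i *_) (none (b ∸ i))) (ℤ.*-zeroʳ (minus1 ^ i)))
          (sym (⟦⟧-no (ν ≟ₗ replicate (suc b) 1) λ ν≡column → contradiction
            (trans (sym (columnCount-hook-leg 0 b)) (subst (λ κ → columnCount κ b ≡ + 0) ν≡column (none b))) λ ()))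

  sum-hstrips-column : ∀ ν a m →
    sumℤ (map (λ ρ → + 1 * ⟦ ρ ≟ₗ replicate m 1 ⟧) (hstrips ν a)) ≡ ⟦ sumℕ ν ≟ a +ℕ m ⟧ * columnCount ν m
  sum-hstrips-column ν a m = begin
    sumℤ (map (λ ρ → + 1 * ⟦ ρ ≟ₗ replicate m 1 ⟧) (hstrips ν a))
      ≡⟨ sum-hstrips ν a _ ⟩
    sumℤ (map (λ ρ → ⟦ sumℕ ν ≟ a +ℕ sumℕ (stripZ ρ) ⟧ * (+ 1 * ⟦ stripZ ρ ≟ₗ replicate m 1 ⟧)) (interlace ν))
      ≡⟨ sum-map-cong (interlace ν) (column-term ∘ stripZ) ⟩
    sumℤ (map (λ ρ → ⟦ sumℕ ν ≟ a +ℕ m ⟧ * ⟦ stripZ ρ ≟ₗ replicate m 1 ⟧) (interlace ν))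
      ≡⟨ sum-map-*ˡ ⟦ sumℕ ν ≟ a +ℕ m ⟧ _ (interlace ν) ⟩
    ⟦ sumℕ ν ≟ a +ℕ m ⟧ * columnCount ν m ∎
    where
    open ≡-Reasoning
    column-term : ∀ σ → ⟦ sumℕ ν ≟ a +ℕ sumℕ σ ⟧ * (+ 1 * ⟦ σ ≟ₗ replicate m 1 ⟧)
                          ≡ ⟦ sumℕ ν ≟ a +ℕ m ⟧ * ⟦ σ ≟ₗ replicate m 1 ⟧
    column-term σ with σ ≟ₗ replicate m 1
    ... | yes refl rewrite sumℕ-replicate m = refl
    ... | no _     = trans (ℤ.*-zeroʳ ⟦ sumℕ ν ≟ a +ℕ sumℕ σ ⟧) (sym (ℤ.*-zeroʳ ⟦ sumℕ ν ≟ a +ℕ m ⟧))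

  pairE-schur : ∀ f b ν → b ≤ f → Positive ν → pairE f b (chainSum unitWeight ν) ≡ ⟦ ν ≟ₗ replicate b 1 ⟧
  pairE-schur-∷ : ∀ f m a ν → m ≤ f →
    pairE f m (λ δ → chainSum unitWeight ν (a ∷ δ)) ≡ ⟦ sumℕ ν ≟ a +ℕ m ⟧ * columnCount ν m

  pairE-schur f       zero    []      _         _  = refl
  pairE-schur f       zero    (_ ∷ _) _         _  = refl
  pairE-schur (suc f) (suc b) ν       (s≤s b≤f) ν⁺ = begin
    pairE (suc f) (suc b) (chainSum unitWeight ν)
      ≡⟨⟩
    ∑[ i < suc b ] (minus1 ^ i * pairE f (b ∸ i) (λ δ → chainSum unitWeight ν (suc i ∷ δ)))
      ≡⟨ ∑-cong (suc b) (λ i i<1+b → cong (minus1 ^ i *_) (strip i i<1+b)) ⟩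
    ∑[ i < suc b ] (minus1 ^ i * (⟦ sumℕ ν ≟ suc b ⟧ * columnCount ν (b ∸ i)))
      ≡⟨ ∑-cong (suc b) (λ i _ → x*[y*z]≡y*[x*z] (minus1 ^ i) ⟦ sumℕ ν ≟ suc b ⟧ (columnCount ν (b ∸ i))) ⟩
    ∑[ i < suc b ] (⟦ sumℕ ν ≟ suc b ⟧ * (minus1 ^ i * columnCount ν (b ∸ i)))
      ≡⟨ ∑-*ˡ (suc b) ⟦ sumℕ ν ≟ suc b ⟧ (λ i → minus1 ^ i * columnCount ν (b ∸ i)) ⟩
    ⟦ sumℕ ν ≟ suc b ⟧ * ∑[ i < suc b ] (minus1 ^ i * columnCount ν (b ∸ i))
      ≡⟨ by-size ⟩
    ⟦ ν ≟ₗ replicate (suc b) 1 ⟧ ∎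
    where
    open ≡-Reasoning
    strip : ∀ i → i < suc b → pairE f (b ∸ i) (λ δ → chainSum unitWeight ν (suc i ∷ δ))
                               ≡ ⟦ sumℕ ν ≟ suc b ⟧ * columnCount ν (b ∸ i)
    strip i (s≤s i≤b) = trans (pairE-schur-∷ f (b ∸ i) (suc i) ν (ℕ.≤-trans (ℕ.m∸n≤m b i) b≤f))
      (cong (λ k → ⟦ sumℕ ν ≟ suc k ⟧ * columnCount ν (b ∸ i)) (ℕ.m+[n∸m]≡n i≤b))
    alternating : ℤ
    alternating = ∑[ i < suc b ] (minus1 ^ i * columnCount ν (b ∸ i))
    by-size : ⟦ sumℕ ν ≟ suc b ⟧ * alternating ≡ ⟦ ν ≟ₗ replicate (suc b) 1 ⟧
    by-size with sumℕ ν ≟ suc b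
    ... | yes |ν|≡1+b = trans (cong (_* alternating) (⟦⟧-yes (sumℕ ν ≟ suc b) |ν|≡1+b))
                              (trans (ℤ.*-identityˡ alternating) (alternating-columnCount b ν⁺ |ν|≡1+b))
    ... | no |ν|≢1+b  = trans (cong (_* alternating) (⟦⟧-no (sumℕ ν ≟ suc b) |ν|≢1+b))
                              (sym (⟦⟧-no (ν ≟ₗ replicate (suc b) 1) λ ν≡column →
                                |ν|≢1+b (trans (cong sumℕ ν≡column) (sumℕ-replicate (suc b)))))

  pairE-schur-∷ f m a ν m≤f = begin
    pairE f m (λ δ → chainSum unitWeight ν (a ∷ δ))
      ≡⟨ pairE-chainSum-∷ unitWeight f m ν a ⟩
    sumℤ (map (λ ρ → + 1 * pairE f m (chainSum unitWeight ρ)) (hstrips ν a))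
      ≡⟨ sum-map-congᴬ (All.map (λ ρ⁺ → cong (+ 1 *_) (pairE-schur f m _ m≤f ρ⁺)) (hstrips-positive ν a)) ⟩
    sumℤ (map (λ ρ → + 1 * ⟦ ρ ≟ₗ replicate m 1 ⟧) (hstrips ν a))
      ≡⟨ sum-hstrips-column ν a m ⟩
    ⟦ sumℕ ν ≟ a +ℕ m ⟧ * columnCount ν m ∎
    where open ≡-Reasoning

  hook≡hookShape : ∀ {n j} → j < n → hook n j ≡ hookShape (n ∸ suc j) j
  hook≡hookShape {n} {j} j<n = cong (_∷ replicate j 1) (∸-suc j<n)

  hookShape≡hook⇔ : ∀ {p q n k} → k ≤ n → hookShape p q ≡ hook n k → suc p +ℕ q ≡ n × k ≡ q
  hookShape≡hook⇔ {p} {q} {n} {k} k≤n eq = (begin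
    suc p +ℕ q       ≡⟨ cong₂ _+ℕ_ (List.∷-injectiveˡ eq) (sym k≡q) ⟩
    (n ∸ k) +ℕ k     ≡⟨ ℕ.m∸n+n≡m k≤n ⟩
    n                ∎) , k≡q
    where
    open ≡-Reasoning
    k≡q : k ≡ q
    k≡q = trans (sym (List.length-replicate k)) (trans (cong length (sym (List.∷-injectiveʳ eq))) (List.length-replicate q))

  ⟦hookShape≟hook⟧ : ∀ p q n k → k ≤ n →
    ⟦ hookShape p q ≟ₗ hook n k ⟧ ≡ ⟦ suc p +ℕ q ≟ n ⟧ * ⟦ k ≟ q ⟧
  ⟦hookShape≟hook⟧ p q n k k≤n = trans
    (⟦⟧-⇔ (hookShape p q ≟ₗ hook n k) ((suc p +ℕ q ≟ n) ×-dec (k ≟ q)) (hookShape≡hook⇔ k≤n) same)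
    (sym (⟦⟧-× (suc p +ℕ q ≟ n) (k ≟ q)))
    where
    same : suc p +ℕ q ≡ n × k ≡ q → hookShape p q ≡ hook n k
    same (refl , refl) = cong (_∷ replicate q 1) (sym (ℕ.m+n∸n≡m (suc p) q))

  columnCount-hooks : ∀ {κ} n j → Positive κ → j < n →
    ⟦ sumℕ κ ≟ n ⟧ * columnCount κ j ≡ ⟦ κ ≟ₗ hook n j ⟧ + prev (λ k → ⟦ κ ≟ₗ hook n k ⟧) j
  columnCount-hooks {κ} n j κ⁺ j<n with columnCount-classify κ⁺
  ... | inj₁ refl = trans (cong (_* columnCount [] j) (⟦⟧-no (0 ≟ n) (ℕ.<⇒≢ (ℕ.≤-<-trans z≤n j<n))))
                          (sym (cong (_+_ (+ 0)) (prev-zero j _ (λ _ _ → refl))))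
  ... | inj₂ (inj₂ none) = begin
    ⟦ sumℕ κ ≟ n ⟧ * columnCount κ j
      ≡⟨ cong (⟦ sumℕ κ ≟ n ⟧ *_) (none j) ⟩
    ⟦ sumℕ κ ≟ n ⟧ * + 0
      ≡⟨ ℤ.*-zeroʳ ⟦ sumℕ κ ≟ n ⟧ ⟩
    + 0 + + 0
      ≡⟨ sym (cong₂ _+_ (not-hook j j<n)
                        (prev-zero j _ λ k 1+k≡j → not-hook k (ℕ.<-trans (ℕ.≤-reflexive 1+k≡j) j<n))) ⟩
    ⟦ κ ≟ₗ hook n j ⟧ + prev (λ k → ⟦ κ ≟ₗ hook n k ⟧) j ∎
    where
    open ≡-Reasoning
    not-hook : ∀ k → k < n → ⟦ κ ≟ₗ hook n k ⟧ ≡ + 0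
    not-hook k k<n = ⟦⟧-no (κ ≟ₗ hook n k) λ κ≡hook → contradiction
      (trans (sym (columnCount-hook-leg (n ∸ suc k) k))
             (subst (λ ν → columnCount ν k ≡ + 0) (trans κ≡hook (hook≡hookShape k<n)) (none k))) λ ()
  ... | inj₂ (inj₁ (p , q , refl)) = begin
    ⟦ sumℕ (hookShape p q) ≟ n ⟧ * columnCount (hookShape p q) j
      ≡⟨ cong₂ (λ s c → ⟦ s ≟ n ⟧ * c) (sumℕ-hookShape p q) (columnCount-hook p q j) ⟩
    ⟦ suc p +ℕ q ≟ n ⟧ * (⟦ j ≟ q ⟧ + ⟦ j ≟ suc q ⟧)
      ≡⟨ ℤ.*-distribˡ-+ ⟦ suc p +ℕ q ≟ n ⟧ ⟦ j ≟ q ⟧ ⟦ j ≟ suc q ⟧ ⟩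
    ⟦ suc p +ℕ q ≟ n ⟧ * ⟦ j ≟ q ⟧ + ⟦ suc p +ℕ q ≟ n ⟧ * ⟦ j ≟ suc q ⟧
      ≡⟨ cong₂ _+_ (sym (⟦hookShape≟hook⟧ p q n j (ℕ.<⇒≤ j<n))) (below j j<n) ⟩
    ⟦ hookShape p q ≟ₗ hook n j ⟧ + prev (λ k → ⟦ hookShape p q ≟ₗ hook n k ⟧) j ∎
    where
    open ≡-Reasoning
    below : ∀ j → j < n → ⟦ suc p +ℕ q ≟ n ⟧ * ⟦ j ≟ suc q ⟧ ≡ prev (λ k → ⟦ hookShape p q ≟ₗ hook n k ⟧) j
    below zero    _   = ℤ.*-zeroʳ ⟦ suc p +ℕ q ≟ n ⟧
    below (suc j) j<n = sym (⟦hookShape≟hook⟧ p q n j (ℕ.<⇒≤ (ℕ.<-trans (ℕ.n<1+n j) j<n)))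

  hookShape-decreasing : ∀ p q → Decreasing (hookShape p q)
  hookShape-decreasing p zero    = [-]
  hookShape-decreasing p (suc q) = s≤s z≤n ∷ hookShape-decreasing 0 q

  hookShape-positive : ∀ p q → Positive (hookShape p q)
  hookShape-positive p q = s≤s z≤n ∷ All.replicate⁺ q (s≤s z≤n)

  headℕ-decreasing : ∀ {x κ} → Decreasing (x ∷ κ) → headℕ κ ≤ x
  headℕ-decreasing [-]       = z≤n
  headℕ-decreasing (y≤x ∷ _) = y≤x

  partsF-positive : ∀ f N m → All Positive (partsF f N m)
  partsF-positive f       zero    m = [] ∷ []
  partsF-positive zero    (suc N) m = []
  partsF-positive (suc f) (suc N) m = All.concat⁺ (All.map⁺ (All.map
    (λ {k} (1≤k , _) → All.map⁺ (All.map (1≤k ∷_) (partsF-positive f (suc N ∸ k) k)))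
    (range-bounds 1 (m ⊓ suc N))))

  sum-partsF-pick : ∀ f N m (G : List ℕ → ℤ) κ →
    Decreasing κ → Positive κ → sumℕ κ ≡ N → headℕ κ ≤ m → N ≤ f →
    sumℤ (map (λ l → G l * ⟦ l ≟ₗ κ ⟧) (partsF f N m)) ≡ G κ
  sum-partsF-pick f .0 m G [] _ _ refl _ _ = trans (ℤ.+-identityʳ (G [] * + 1)) (ℤ.*-identityʳ (G []))
  sum-partsF-pick (suc f) (suc N) m G (suc k ∷ κ) κ↓ (_ ∷ κ⁺) |κ| 1+k≤m (s≤s N≤f) = begin
    sumℤ (map F (partsF (suc f) (suc N) m))
      ≡⟨ sum-map-concatMap F (λ k′ → map (k′ ∷_) (partsF f (suc N ∸ k′) k′)) (range 1 (m ⊓ suc N)) ⟩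
    sumℤ (map (λ k′ → sumℤ (map F (map (k′ ∷_) (partsF f (suc N ∸ k′) k′)))) (range 1 (m ⊓ suc N)))
      ≡⟨ sum-map-range (λ k′ → sumℤ (map F (map (k′ ∷_) (partsF f (suc N ∸ k′) k′)))) 1 (m ⊓ suc N) ⟩
    ∑[ i < m ⊓ suc N ] sumℤ (map F (map (suc i ∷_) (partsF f (N ∸ i) (suc i))))
      ≡⟨ ∑-single k (ℕ.⊓-pres-m< 1+k≤m (s≤s k≤N)) other-first-part ⟩
    sumℤ (map F (map (suc k ∷_) (partsF f (N ∸ k) (suc k))))
      ≡⟨ sum-map-map F (suc k ∷_) (partsF f (N ∸ k) (suc k)) ⟩
    sumℤ (map (λ l → G (suc k ∷ l) * ⟦ suc k ∷ l ≟ₗ suc k ∷ κ ⟧) (partsF f (N ∸ k) (suc k)))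
      ≡⟨ sum-map-cong (partsF f (N ∸ k) (suc k)) (λ l → cong (G (suc k ∷ l) *_) (same-first-part l)) ⟩
    sumℤ (map (λ l → G (suc k ∷ l) * ⟦ l ≟ₗ κ ⟧) (partsF f (N ∸ k) (suc k)))
      ≡⟨ sum-partsF-pick f (N ∸ k) (suc k) (G ∘ (suc k ∷_)) κ (Linked.tail κ↓) κ⁺ |κ|≡N∸k
                         (headℕ-decreasing κ↓) (ℕ.≤-trans (ℕ.m∸n≤m N k) N≤f) ⟩
    G (suc k ∷ κ) ∎
    where
    open ≡-Reasoning
    F : List ℕ → ℤ
    F l = G l * ⟦ l ≟ₗ suc k ∷ κ ⟧
    k+|κ|≡N : k +ℕ sumℕ κ ≡ N
    k+|κ|≡N = ℕ.suc-injective |κ|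
    k≤N : k ≤ N
    k≤N = subst (k ≤_) k+|κ|≡N (ℕ.m≤m+n k (sumℕ κ))
    |κ|≡N∸k : sumℕ κ ≡ N ∸ k
    |κ|≡N∸k = trans (sym (ℕ.m+n∸m≡n k (sumℕ κ))) (cong (_∸ k) k+|κ|≡N)
    same-first-part : ∀ l → ⟦ suc k ∷ l ≟ₗ suc k ∷ κ ⟧ ≡ ⟦ l ≟ₗ κ ⟧
    same-first-part l = trans (⟦∷≟ₗ∷⟧ (suc k) (suc k) l κ)
      (trans (cong (_* ⟦ l ≟ₗ κ ⟧) (⟦⟧-yes (k ≟ k) refl)) (ℤ.*-identityˡ ⟦ l ≟ₗ κ ⟧))
    other-first-part : ∀ i → i < m ⊓ suc N → i ≢ k → sumℤ (map F (map (suc i ∷_) (partsF f (N ∸ i) (suc i)))) ≡ + 0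
    other-first-part i _ i≢k = trans (sum-map-map F (suc i ∷_) (partsF f (N ∸ i) (suc i)))
      (sum-map-zero (partsF f (N ∸ i) (suc i)) λ l → trans
        (cong (G (suc i ∷ l) *_) (⟦⟧-no (suc i ∷ l ≟ₗ suc k ∷ κ) (i≢k ∘ ℕ.suc-injective ∘ List.∷-injectiveˡ)))
        (ℤ.*-zeroʳ (G (suc i ∷ l))))

  sum-partitions-hook : ∀ n j (G : List ℕ → ℤ) → j < n →
    sumℤ (map (λ l → G l * ⟦ l ≟ₗ hook n j ⟧) (partitions n)) ≡ G (hook n j)
  sum-partitions-hook n j G j<n rewrite hook≡hookShape j<n =
    sum-partsF-pick n n n G (hookShape (n ∸ suc j) j) (hookShape-decreasing _ j) (hookShape-positive _ j)
      (trans (sumℕ-hookShape (n ∸ suc j) j) (trans (cong (_+ℕ j) (sym (∸-suc j<n))) (ℕ.m∸n+n≡m (ℕ.<⇒≤ j<n))))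
      (subst (_≤ n) (∸-suc j<n) (ℕ.m∸n≤m n j)) ℕ.≤-refl

  pairE-schurExpansion : ∀ n j (g : List ℕ → ℤ) → j < n →
    pairE j j (λ δ → sumℤ (map (λ κ → g κ * coeffS κ (reverse (n ∸ j ∷ δ))) (partitions n)))
      ≡ g (hook n j) + prev (g ∘ hook n) j
  pairE-schurExpansion n j g j<n = begin
    pairE j j (λ δ → sumℤ (map (λ κ → g κ * coeffS κ (reverse (n ∸ j ∷ δ))) (partitions n)))
      ≡⟨ pairE-sum j j g (λ κ δ → coeffS κ (reverse (n ∸ j ∷ δ))) (partitions n) ⟩
    sumℤ (map (λ κ → g κ * pairE j j (λ δ → coeffS κ (reverse (n ∸ j ∷ δ)))) (partitions n))
      ≡⟨ sum-map-congᴬ (All.map (λ {κ} κ⁺ → cong (g κ *_) (schur-term κ⁺)) (partsF-positive n n n)) ⟩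
    sumℤ (map (λ κ → g κ * (⟦ κ ≟ₗ hook n j ⟧ + prev (λ k → ⟦ κ ≟ₗ hook n k ⟧) j)) (partitions n))
      ≡⟨ sum-map-cong (partitions n) (λ κ → ℤ.*-distribˡ-+ (g κ) ⟦ κ ≟ₗ hook n j ⟧ _) ⟩
    sumℤ (map (λ κ → g κ * ⟦ κ ≟ₗ hook n j ⟧ + g κ * prev (λ k → ⟦ κ ≟ₗ hook n k ⟧) j) (partitions n))
      ≡⟨ sum-map-+ (λ κ → g κ * ⟦ κ ≟ₗ hook n j ⟧) (λ κ → g κ * prev (λ k → ⟦ κ ≟ₗ hook n k ⟧) j)
                   (partitions n) ⟩
    sumℤ (map (λ κ → g κ * ⟦ κ ≟ₗ hook n j ⟧) (partitions n))
      + sumℤ (map (λ κ → g κ * prev (λ k → ⟦ κ ≟ₗ hook n k ⟧) j) (partitions n))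
      ≡⟨ cong₂ _+_ (sum-partitions-hook n j g j<n) (previous-hook j j<n) ⟩
    g (hook n j) + prev (g ∘ hook n) j ∎
    where
    open ≡-Reasoning
    schur-term : ∀ {κ} → Positive κ → pairE j j (λ δ → coeffS κ (reverse (n ∸ j ∷ δ)))
                                        ≡ ⟦ κ ≟ₗ hook n j ⟧ + prev (λ k → ⟦ κ ≟ₗ hook n k ⟧) j
    schur-term {κ} κ⁺ = begin
      pairE j j (λ δ → coeffS κ (reverse (n ∸ j ∷ δ)))
        ≡⟨ pairE-cong j j (λ δ → cong (chainSum unitWeight κ) (List.reverse-involutive (n ∸ j ∷ δ))) ⟩
      pairE j j (λ δ → chainSum unitWeight κ (n ∸ j ∷ δ))
        ≡⟨ pairE-schur-∷ j j (n ∸ j) κ ℕ.≤-refl ⟩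
      ⟦ sumℕ κ ≟ n ∸ j +ℕ j ⟧ * columnCount κ j
        ≡⟨ cong (λ m → ⟦ sumℕ κ ≟ m ⟧ * columnCount κ j) (ℕ.m∸n+n≡m (ℕ.<⇒≤ j<n)) ⟩
      ⟦ sumℕ κ ≟ n ⟧ * columnCount κ j
        ≡⟨ columnCount-hooks n j κ⁺ j<n ⟩
      ⟦ κ ≟ₗ hook n j ⟧ + prev (λ k → ⟦ κ ≟ₗ hook n k ⟧) j ∎
    previous-hook : ∀ j → j < n →
      sumℤ (map (λ κ → g κ * prev (λ k → ⟦ κ ≟ₗ hook n k ⟧) j) (partitions n)) ≡ prev (g ∘ hook n) j
    previous-hook zero    _   = sum-map-zero (partitions n) (λ κ → ℤ.*-zeroʳ (g κ))
    previous-hook (suc j) j<n = sum-partitions-hook n j g (ℕ.<-trans (ℕ.n<1+n j) j<n)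

  -- Hall–Littlewood functions at t = -1

  ψ₋₁ : List ℕ → List ℕ → ℤ
  ψ₋₁ = ψ minus1

  θ : List ℕ → List ℕ → ℕ → ℕ
  θ μ ν j = conj μ j ∸ conj ν j

  -- the factor of ψ minus1 μ ν at j, which Defs keeps local to ψ
  ψ₋₁-factor : List ℕ → List ℕ → ℕ → ℤ
  ψ₋₁-factor μ ν j = if (θ μ ν j ≡ᵇ 0) ∧ (θ μ ν (suc j) ≡ᵇ 1) then + 1 - minus1 ^ mult ν j else + 1

  ψ₋₁≡∏ : ∀ μ ν → ψ₋₁ μ ν ≡ ∏[ i < headℕ μ ] ψ₋₁-factor μ ν (suc i)
  ψ₋₁≡∏ μ ν = prod-map-range (ψ₋₁-factor μ ν) 1 (headℕ μ)

  ψ₋₁-factor-corner : ∀ μ ν j → θ μ ν j ≡ 0 → θ μ ν (suc j) ≡ 1 →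
    ψ₋₁-factor μ ν j ≡ + 1 - minus1 ^ mult ν j
  ψ₋₁-factor-corner μ ν j θⱼ≡0 θⱼ₊₁≡1 rewrite θⱼ≡0 | θⱼ₊₁≡1 = refl

  ψ₋₁-factor-θ≡1 : ∀ μ ν j → θ μ ν j ≡ 1 → ψ₋₁-factor μ ν j ≡ + 1
  ψ₋₁-factor-θ≡1 μ ν j θⱼ≡1 rewrite θⱼ≡1 = refl

  ψ₋₁-factor-θ₊₁≡0 : ∀ μ ν j → θ μ ν (suc j) ≡ 0 → ψ₋₁-factor μ ν j ≡ + 1
  ψ₋₁-factor-θ₊₁≡0 μ ν j θⱼ₊₁≡0 rewrite θⱼ₊₁≡0 | Bool.∧-zeroʳ (θ μ ν j ≡ᵇ 0) = refl

  conj-≤ : ∀ {x j} xs → j ≤ x → conj (x ∷ xs) j ≡ suc (conj xs j)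
  conj-≤ {x} {j} xs j≤x with x <ᵇ j | ℕ.<ᵇ-reflects-< x j
  ... | false | _       = refl
  ... | true  | ofʸ x<j = contradiction j≤x (ℕ.<⇒≱ x<j)

  conj-> : ∀ {x j} xs → x < j → conj (x ∷ xs) j ≡ conj xs j
  conj-> {x} {j} xs x<j with x <ᵇ j | ℕ.<ᵇ-reflects-< x j
  ... | true  | _       = refl
  ... | false | ofⁿ x≮j = contradiction x<j x≮j

  mult-self : ∀ y xs → mult (y ∷ xs) y ≡ suc (mult xs y)
  mult-self y xs with y ≡ᵇ y | ℕ.≡⇒≡ᵇ y y refl
  ... | true | _ = refl

  -- σ has the column lengths of the one-row partition (s)
  record OneRow (s : ℕ) (σ : List ℕ) : Set where
    field
      conj-≤ₛ : ∀ {j} → 1 ≤ j → j ≤ s → conj σ j ≡ 1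
      conj->ₛ : ∀ {j} → s < j → conj σ j ≡ 0

  open OneRow

  oneRow-[] : OneRow 0 []
  oneRow-[] = record { conj-≤ₛ = λ { (s≤s _) () } ; conj->ₛ = λ _ → refl }

  oneRow-∷ : ∀ s → OneRow s (s ∷ [])
  oneRow-∷ s = record { conj-≤ₛ = λ _ j≤s → conj-≤ [] j≤s ; conj->ₛ = conj-> [] }

  module OneRowPair {p s y σ ν} (σ-row : OneRow s σ) (ν-row : OneRow y ν) (s≤y : s ≤ y) (y≤p : y ≤ p) where

    private
      μ : List ℕ
      μ = p ∷ σ

      θ-below : ∀ {j} → 1 ≤ j → j ≤ s → θ μ ν j ≡ 1
      θ-below 1≤j j≤s rewrite conj-≤ σ (ℕ.≤-trans j≤s (ℕ.≤-trans s≤y y≤p))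
                            | conj-≤ₛ σ-row 1≤j j≤s | conj-≤ₛ ν-row 1≤j (ℕ.≤-trans j≤s s≤y) = refl

      θ-inside : ∀ {j} → s < j → j ≤ y → θ μ ν j ≡ 0
      θ-inside {j} s<j j≤y rewrite conj-≤ σ (ℕ.≤-trans j≤y y≤p)
                                  | conj->ₛ σ-row s<j | conj-≤ₛ ν-row (ℕ.≤-trans (s≤s z≤n) s<j) j≤y = refl

      θ-outside : ∀ {j} → y < j → j ≤ p → θ μ ν j ≡ 1
      θ-outside y<j j≤p rewrite conj-≤ σ j≤p | conj->ₛ σ-row (ℕ.≤-<-trans s≤y y<j) | conj->ₛ ν-row y<j = refl

      θ-beyond : ∀ {j} → p < j → θ μ ν j ≡ 0
      θ-beyond p<j rewrite conj-> σ p<j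
                         | conj->ₛ σ-row (ℕ.≤-<-trans (ℕ.≤-trans s≤y y≤p) p<j)
                         | conj->ₛ ν-row (ℕ.≤-<-trans y≤p p<j) = refl

      factor-one : ∀ j → 1 ≤ j → j ≤ p → ¬ (j ≡ y × s < y × y < p) → ψ₋₁-factor μ ν j ≡ + 1
      factor-one j 1≤j j≤p not-corner with ℕ.≤-<-connex j s
      ... | inj₁ j≤s = ψ₋₁-factor-θ≡1 μ ν j (θ-below 1≤j j≤s)
      ... | inj₂ s<j with ℕ.<-cmp j y
      ...   | tri< j<y _ _ = ψ₋₁-factor-θ₊₁≡0 μ ν j (θ-inside (ℕ.<-trans s<j (ℕ.n<1+n j)) j<y)
      ...   | tri> _ _ y<j = ψ₋₁-factor-θ≡1 μ ν j (θ-outside y<j j≤p)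
      ...   | tri≈ _ refl _ with ℕ.m≤n⇒m<n∨m≡n y≤p
      ...     | inj₁ y<p  = contradiction (refl , s<j , y<p) not-corner
      ...     | inj₂ refl = ψ₋₁-factor-θ₊₁≡0 μ ν p (θ-beyond (ℕ.n<1+n p))

    ψ₋₁-oneRow-flat : ¬ (s < y × y < p) → ψ₋₁ (p ∷ σ) ν ≡ + 1
    ψ₋₁-oneRow-flat no-corner = trans (ψ₋₁≡∏ μ ν)
      (∏-one p (λ i i<p → factor-one (suc i) (s≤s z≤n) i<p (λ (_ , corner) → no-corner corner)))

    ψ₋₁-oneRow-corner : s < y → y < p → ψ₋₁ (p ∷ σ) ν ≡ + 1 - minus1 ^ mult ν y
    ψ₋₁-oneRow-corner s<y y<p = trans (ψ₋₁≡∏ μ ν) (trans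
      (∏-single (y ∸ 1) (ℕ.≤-<-trans (ℕ.m∸n≤m y 1) y<p)
        (λ i i<p i≢y∸1 → factor-one (suc i) (s≤s z≤n) i<p (λ (1+i≡y , _) → i≢y∸1 (cong (_∸ 1) 1+i≡y))))
      (trans (cong (ψ₋₁-factor μ ν) 1+[y∸1]≡y)
             (ψ₋₁-factor-corner μ ν y (θ-inside s<y ℕ.≤-refl) (θ-outside (ℕ.n<1+n y) y<p))))
      where
      1+[y∸1]≡y : suc (y ∸ 1) ≡ y
      1+[y∸1]≡y = ℕ.m+[n∸m]≡n (ℕ.≤-trans (s≤s z≤n) s<y)

  ψ₋₁-square-strip : ∀ p s → 1 ≤ s → s < p → ψ₋₁ (p ∷ s ∷ []) (s ∷ s ∷ []) ≡ + 0
  ψ₋₁-square-strip p s 1≤s s<p = trans (ψ₋₁≡∏ μ ν) (∏-zero (s ∸ 1) (ℕ.≤-<-trans (ℕ.m∸n≤m s 1) s<p) (begin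
    ψ₋₁-factor μ ν (suc (s ∸ 1))        ≡⟨ cong (ψ₋₁-factor μ ν) (ℕ.m+[n∸m]≡n 1≤s) ⟩
    ψ₋₁-factor μ ν s                    ≡⟨ ψ₋₁-factor-corner μ ν s θₛ≡0 θₛ₊₁≡1 ⟩
    + 1 - minus1 ^ mult ν s             ≡⟨ cong (λ k → + 1 - minus1 ^ k) mult≡2 ⟩
    + 0                                 ∎))
    where
    open ≡-Reasoning
    μ ν : List ℕ
    μ = p ∷ s ∷ []
    ν = s ∷ s ∷ []
    mult≡2 : mult ν s ≡ 2
    mult≡2 = trans (mult-self s (s ∷ [])) (cong suc (mult-self s []))
    θₛ≡0 : θ μ ν s ≡ 0
    θₛ≡0 rewrite conj-≤ (s ∷ []) (ℕ.<⇒≤ s<p) | conj-≤ (s ∷ []) (ℕ.≤-refl {s}) | conj-≤ [] (ℕ.≤-refl {s}) = refl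
    θₛ₊₁≡1 : θ μ ν (suc s) ≡ 1
    θₛ₊₁≡1 rewrite conj-≤ (s ∷ []) s<p | conj-> (s ∷ []) (ℕ.n<1+n s) | conj-> [] (ℕ.n<1+n s) = refl

  row : ℕ → List ℕ
  row x = stripZ (x ∷ [])

  oneRow-row : ∀ x → OneRow x (row x)
  oneRow-row zero    = oneRow-[]
  oneRow-row (suc x) = oneRow-∷ (suc x)

  sumℕ-row : ∀ x → sumℕ (row x) ≡ x
  sumℕ-row zero    = refl
  sumℕ-row (suc x) = cong suc (ℕ.+-identityʳ x)

  ψ₋₁-row-empty : ∀ p → ψ₋₁ (p ∷ []) [] ≡ + 1
  ψ₋₁-row-empty p = OneRowPair.ψ₋₁-oneRow-flat oneRow-[] oneRow-[] z≤n (z≤n {p}) λ ()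

  ψ₋₁-row-row : ∀ p y → suc y < p → ψ₋₁ (p ∷ []) (suc y ∷ []) ≡ + 2
  ψ₋₁-row-row p y 1+y<p = trans (OneRowPair.ψ₋₁-oneRow-corner oneRow-[] (oneRow-∷ (suc y)) z≤n (ℕ.<⇒≤ 1+y<p) z<s 1+y<p)
                                (cong (λ k → + 1 - minus1 ^ k) (mult-self (suc y) []))

  ψ₋₁-twoRow-row-flat : ∀ p s y → s ≤ y → y ≤ p → ¬ (s < y × y < p) → ψ₋₁ (p ∷ s ∷ []) (row y) ≡ + 1
  ψ₋₁-twoRow-row-flat p s y s≤y y≤p = OneRowPair.ψ₋₁-oneRow-flat (oneRow-∷ s) (oneRow-row y) s≤y y≤p

  ψ₋₁-twoRow-row-corner : ∀ p s y → s < suc y → suc y < p → ψ₋₁ (p ∷ s ∷ []) (suc y ∷ []) ≡ + 2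
  ψ₋₁-twoRow-row-corner p s y s<1+y 1+y<p =
    trans (OneRowPair.ψ₋₁-oneRow-corner (oneRow-∷ s) (oneRow-∷ (suc y)) (ℕ.<⇒≤ s<1+y) (ℕ.<⇒≤ 1+y<p) s<1+y 1+y<p)
          (cong (λ k → + 1 - minus1 ^ k) (mult-self (suc y) []))

  stripTerm : (List ℕ → List ℕ → ℤ) → ℕ → ℕ → List ℕ → ℕ → List ℕ → ℤ
  stripTerm w f m ν a ρ = ⟦ sumℕ ν ≟ a +ℕ sumℕ ρ ⟧ * (w ν ρ * pairE f m (chainSum w ρ))

  pairE-chainSum-row : ∀ w f m x a →
    pairE f m (λ δ → chainSum w (x ∷ []) (a ∷ δ)) ≡ ∑[ y < suc x ] stripTerm w f m (x ∷ []) a (row y)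
  pairE-chainSum-row w f m x a = trans (pairE-chainSum-∷ w f m (x ∷ []) a)
    (trans (sum-hstrips (x ∷ []) a _) (sum-interlace-row x (stripTerm w f m (x ∷ []) a ∘ stripZ)))

  pairE-chainSum-twoRow : ∀ w f m p q a → pairE f m (λ δ → chainSum w (p ∷ q ∷ []) (a ∷ δ))
    ≡ ∑[ u < suc p ∸ q ] ∑[ y < suc q ] stripTerm w f m (p ∷ q ∷ []) a (stripZ (q +ℕ u ∷ y ∷ []))
  pairE-chainSum-twoRow w f m p q a = trans (pairE-chainSum-∷ w f m (p ∷ q ∷ []) a)
    (trans (sum-hstrips (p ∷ q ∷ []) a _) (sum-interlace-twoRow p q (stripTerm w f m (p ∷ q ∷ []) a ∘ stripZ)))

  strip-size-shift : ∀ S a m y F →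
    ⟦ S ≟ a +ℕ sumℕ (row y) ⟧ * (F * ⟦ m ≟ y ⟧) ≡ ⟦ S ≟ a +ℕ m ⟧ * (F * ⟦ m ≟ y ⟧)
  strip-size-shift S a m y F = shift (m ≟ y)
    where
    shift : (d : Dec (m ≡ y)) → ⟦ S ≟ a +ℕ sumℕ (row y) ⟧ * (F * ⟦ d ⟧) ≡ ⟦ S ≟ a +ℕ m ⟧ * (F * ⟦ d ⟧)
    shift (yes refl) = cong (λ k → ⟦ S ≟ a +ℕ k ⟧ * (F * + 1)) (sumℕ-row m)
    shift (no _)     = trans (cong (⟦ S ≟ a +ℕ sumℕ (row y) ⟧ *_) (ℤ.*-zeroʳ F))
                      (trans (ℤ.*-zeroʳ ⟦ S ≟ a +ℕ sumℕ (row y) ⟧)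
                      (sym (trans (cong (⟦ S ≟ a +ℕ m ⟧ *_) (ℤ.*-zeroʳ F)) (ℤ.*-zeroʳ ⟦ S ≟ a +ℕ m ⟧))))

  pairE-row : ∀ f m x → m ≤ f → pairE f m (chainSum ψ₋₁ (row x)) ≡ ⟦ m ≟ x ⟧
  pairE-row-∷ : ∀ f m x a → m ≤ f →
    pairE f m (λ δ → chainSum ψ₋₁ (x ∷ []) (a ∷ δ)) ≡ ⟦ x +ℕ 0 ≟ a +ℕ m ⟧ * ψ₋₁ (x ∷ []) (row m)

  pairE-row f       zero    zero    _ = refl
  pairE-row f       zero    (suc x) _ = refl
  pairE-row (suc f) (suc b) zero    _ = ∑-zero (suc b) λ i _ →
    trans (cong (minus1 ^ i *_) (pairE-zero f (b ∸ i) λ _ → refl)) (ℤ.*-zeroʳ (minus1 ^ i))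
  pairE-row (suc f) (suc b) (suc x) (s≤s b≤f) = begin
    pairE (suc f) (suc b) (chainSum ψ₋₁ (suc x ∷ []))
      ≡⟨ ∑-cong (suc b) (λ i i<1+b → cong (minus1 ^ i *_) (strip i i<1+b)) ⟩
    ∑[ i < suc b ] (minus1 ^ i * (c * V i))
      ≡⟨ ∑-cong (suc b) (λ i _ → x*[y*z]≡y*[x*z] (minus1 ^ i) c (V i)) ⟩
    ∑[ i < suc b ] (c * (minus1 ^ i * V i))
      ≡⟨ ∑-*ˡ (suc b) c (λ i → minus1 ^ i * V i) ⟩
    c * ∑[ i < suc b ] (minus1 ^ i * V i)
      ≡⟨ ⟦⟧-guard (suc x +ℕ 0 ≟ suc b) (λ e → ∑-sign-twos-one b V (twos (x≡b e)) one) ⟩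
    c * + 1
      ≡⟨ ℤ.*-identityʳ c ⟩
    c
      ≡⟨ ⟦⟧-⇔ (suc x +ℕ 0 ≟ suc b) (suc b ≟ suc x)
              (sym ∘ trans (sym (ℕ.+-identityʳ (suc x)))) (trans (ℕ.+-identityʳ (suc x)) ∘ sym) ⟩
    ⟦ suc b ≟ suc x ⟧ ∎
    where
    open ≡-Reasoning
    c : ℤ
    c = ⟦ suc x +ℕ 0 ≟ suc b ⟧
    V : ℕ → ℤ
    V i = ψ₋₁ (suc x ∷ []) (row (b ∸ i))
    strip : ∀ i → i < suc b → pairE f (b ∸ i) (λ δ → chainSum ψ₋₁ (suc x ∷ []) (suc i ∷ δ)) ≡ c * V i
    strip i (s≤s i≤b) = trans (pairE-row-∷ f (b ∸ i) (suc x) (suc i) (ℕ.≤-trans (ℕ.m∸n≤m b i) b≤f))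
                              (cong (λ k → ⟦ suc x +ℕ 0 ≟ suc k ⟧ * V i) (ℕ.m+[n∸m]≡n i≤b))
    x≡b : suc x +ℕ 0 ≡ suc b → x ≡ b
    x≡b e = ℕ.suc-injective (trans (sym (ℕ.+-identityʳ (suc x))) e)
    twos : x ≡ b → ∀ i → i < b → V i ≡ + 2
    twos refl i i<x = trans (cong (λ k → ψ₋₁ (suc x ∷ []) (row k)) (∸-suc i<x))
      (ψ₋₁-row-row (suc x) (x ∸ suc i) (s≤s (subst (_≤ x) (∸-suc i<x) (ℕ.m∸n≤m x i))))
    one : V b ≡ + 1
    one = trans (cong (λ k → ψ₋₁ (suc x ∷ []) (row k)) (ℕ.n∸n≡0 b)) (ψ₋₁-row-empty (suc x))

  pairE-row-∷ f m x a m≤f = begin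
    pairE f m (λ δ → chainSum ψ₋₁ (x ∷ []) (a ∷ δ))
      ≡⟨ pairE-chainSum-row ψ₋₁ f m x a ⟩
    ∑[ y < suc x ] stripTerm ψ₋₁ f m (x ∷ []) a (row y)
      ≡⟨ ∑-cong (suc x) (λ y _ → trans
           (cong (λ v → ⟦ x +ℕ 0 ≟ a +ℕ sumℕ (row y) ⟧ * (ψ₋₁ (x ∷ []) (row y) * v)) (pairE-row f m y m≤f))
           (strip-size-shift (x +ℕ 0) a m y (ψ₋₁ (x ∷ []) (row y)))) ⟩
    ∑[ y < suc x ] (c * (ψ₋₁ (x ∷ []) (row y) * ⟦ m ≟ y ⟧))
      ≡⟨ ∑-*ˡ (suc x) c (λ y → ψ₋₁ (x ∷ []) (row y) * ⟦ m ≟ y ⟧) ⟩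
    c * ∑[ y < suc x ] (ψ₋₁ (x ∷ []) (row y) * ⟦ m ≟ y ⟧)
      ≡⟨ ⟦⟧-guard (x +ℕ 0 ≟ a +ℕ m) (λ e → ∑-pick m (λ y → ψ₋₁ (x ∷ []) (row y))
           (s≤s (ℕ.≤-trans (ℕ.m≤n+m m a) (ℕ.≤-reflexive (trans (sym e) (ℕ.+-identityʳ x)))))) ⟩
    c * ψ₋₁ (x ∷ []) (row m) ∎
    where
    open ≡-Reasoning
    c : ℤ
    c = ⟦ x +ℕ 0 ≟ a +ℕ m ⟧

  ∑-sign-pick-+ : ∀ b c u → c +ℕ u ≤ b →
    ∑[ i < suc b ] (minus1 ^ i * ⟦ b ∸ i ≟ c +ℕ u ⟧) ≡ minus1 ^ (b ∸ c) * minus1 ^ u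
  ∑-sign-pick-+ b c u c+u≤b = begin
    ∑[ i < suc b ] (minus1 ^ i * ⟦ b ∸ i ≟ c +ℕ u ⟧)  ≡⟨ ∑-sign-pick b (c +ℕ u) c+u≤b ⟩
    minus1 ^ (b ∸ (c +ℕ u))                           ≡⟨ cong (minus1 ^_) (sym (ℕ.∸-+-assoc b c u)) ⟩
    minus1 ^ (b ∸ c ∸ u)                              ≡⟨ minus1^-∸ (ℕ.m+n≤o⇒m≤o∸n u (subst (_≤ b) (ℕ.+-comm c u) c+u≤b)) ⟩
    minus1 ^ (b ∸ c) * minus1 ^ u                     ∎
    where open ≡-Reasoning

  ∑-sign-ψ₋₁-rows : ∀ p s → suc s < p →
    ∑[ u < p ∸ s ] (minus1 ^ u * ψ₋₁ (p ∷ suc s ∷ []) (row (suc s +ℕ u))) ≡ + 0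
  ∑-sign-ψ₋₁-rows p s 1+s<p =
    trans (cong (λ n → ∑[ u < n ] (minus1 ^ u * V u)) p∸s≡2+D) (∑-sign-one-twos-one D V first middle last)
    where
    V : ℕ → ℤ
    V u = ψ₋₁ (p ∷ suc s ∷ []) (row (suc s +ℕ u))
    D : ℕ
    D = p ∸ suc (suc s)
    p∸s≡2+D : p ∸ s ≡ suc (suc D)
    p∸s≡2+D = trans (∸-suc (ℕ.<-trans (ℕ.n<1+n s) 1+s<p)) (cong suc (∸-suc 1+s<p))
    first : V 0 ≡ + 1
    first = ψ₋₁-twoRow-row-flat p (suc s) (suc s +ℕ 0) (ℕ.m≤m+n (suc s) 0)
      (ℕ.≤-trans (ℕ.≤-reflexive (ℕ.+-identityʳ (suc s))) (ℕ.<⇒≤ 1+s<p))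
      (λ (1+s<1+s+0 , _) → ℕ.<-irrefl (sym (ℕ.+-identityʳ (suc s))) 1+s<1+s+0)
    middle : ∀ u → 0 < u → u ≤ D → V u ≡ + 2
    middle u 0<u u≤D = ψ₋₁-twoRow-row-corner p (suc s) (s +ℕ u) (s≤s (ℕ.m<m+n s 0<u))
      (+-<-∸ (suc s) p (subst (u <_) (sym (∸-suc 1+s<p)) (s≤s u≤D)))
    last : V (suc D) ≡ + 1
    last = trans (cong (λ k → ψ₋₁ (p ∷ suc s ∷ []) (row k)) 1+s+[1+D]≡p)
      (ψ₋₁-twoRow-row-flat p (suc s) p (ℕ.<⇒≤ 1+s<p) ℕ.≤-refl (λ (_ , p<p) → ℕ.<-irrefl refl p<p))
      where
      1+s+[1+D]≡p : suc s +ℕ suc D ≡ p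
      1+s+[1+D]≡p = trans (cong (suc s +ℕ_) (sym (∸-suc 1+s<p))) (ℕ.m+[n∸m]≡n (ℕ.<⇒≤ 1+s<p))

  alternating-twoRow : ∀ p s b → suc s < p → p +ℕ (suc s +ℕ 0) ≡ suc b →
    ∑[ i < suc b ] (minus1 ^ i * ∑[ u < p ∸ s ] (ψ₋₁ (p ∷ suc s ∷ []) (row (suc s +ℕ u)) * ⟦ b ∸ i ≟ suc s +ℕ u ⟧))
      ≡ + 0
  alternating-twoRow p s b 1+s<p |ν|≡1+b = begin
    ∑[ i < suc b ] (minus1 ^ i * ∑[ u < p ∸ s ] (V u * ⟦ b ∸ i ≟ suc s +ℕ u ⟧))
      ≡⟨ ∑-cong (suc b) (λ i _ → sym (∑-*ˡ (p ∸ s) (minus1 ^ i) (λ u → V u * ⟦ b ∸ i ≟ suc s +ℕ u ⟧))) ⟩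
    ∑[ i < suc b ] ∑[ u < p ∸ s ] (minus1 ^ i * (V u * ⟦ b ∸ i ≟ suc s +ℕ u ⟧))
      ≡⟨ ∑-comm (suc b) (p ∸ s) (λ i u → minus1 ^ i * (V u * ⟦ b ∸ i ≟ suc s +ℕ u ⟧)) ⟩
    ∑[ u < p ∸ s ] ∑[ i < suc b ] (minus1 ^ i * (V u * ⟦ b ∸ i ≟ suc s +ℕ u ⟧))
      ≡⟨ ∑-cong (p ∸ s) column ⟩
    ∑[ u < p ∸ s ] (minus1 ^ (b ∸ suc s) * (minus1 ^ u * V u))
      ≡⟨ ∑-*ˡ (p ∸ s) (minus1 ^ (b ∸ suc s)) (λ u → minus1 ^ u * V u) ⟩
    minus1 ^ (b ∸ suc s) * ∑[ u < p ∸ s ] (minus1 ^ u * V u)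
      ≡⟨ cong (minus1 ^ (b ∸ suc s) *_) (∑-sign-ψ₋₁-rows p s 1+s<p) ⟩
    minus1 ^ (b ∸ suc s) * + 0
      ≡⟨ ℤ.*-zeroʳ (minus1 ^ (b ∸ suc s)) ⟩
    + 0 ∎
    where
    open ≡-Reasoning
    V : ℕ → ℤ
    V u = ψ₋₁ (p ∷ suc s ∷ []) (row (suc s +ℕ u))
    p+s≡b : p +ℕ s ≡ b
    p+s≡b = ℕ.suc-injective (trans (sym (trans (cong (p +ℕ_) (ℕ.+-identityʳ (suc s))) (ℕ.+-suc p s))) |ν|≡1+b)
    column : ∀ u → u < p ∸ s →
      ∑[ i < suc b ] (minus1 ^ i * (V u * ⟦ b ∸ i ≟ suc s +ℕ u ⟧)) ≡ minus1 ^ (b ∸ suc s) * (minus1 ^ u * V u)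
    column u u<p∸s = begin
      ∑[ i < suc b ] (minus1 ^ i * (V u * ⟦ b ∸ i ≟ suc s +ℕ u ⟧))
        ≡⟨ ∑-cong (suc b) (λ i _ → x*[y*z]≡y*[x*z] (minus1 ^ i) (V u) ⟦ b ∸ i ≟ suc s +ℕ u ⟧) ⟩
      ∑[ i < suc b ] (V u * (minus1 ^ i * ⟦ b ∸ i ≟ suc s +ℕ u ⟧))
        ≡⟨ ∑-*ˡ (suc b) (V u) (λ i → minus1 ^ i * ⟦ b ∸ i ≟ suc s +ℕ u ⟧) ⟩
      V u * ∑[ i < suc b ] (minus1 ^ i * ⟦ b ∸ i ≟ suc s +ℕ u ⟧)
        ≡⟨ cong (V u *_) (∑-sign-pick-+ b (suc s) u
             (ℕ.≤-trans (+-<-∸ s p u<p∸s) (subst (p ≤_) p+s≡b (ℕ.m≤m+n p s)))) ⟩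
      V u * (minus1 ^ (b ∸ suc s) * minus1 ^ u)
        ≡⟨ trans (x*[y*z]≡y*[x*z] (V u) (minus1 ^ (b ∸ suc s)) (minus1 ^ u))
                 (cong (minus1 ^ (b ∸ suc s) *_) (ℤ.*-comm (V u) (minus1 ^ u))) ⟩
      minus1 ^ (b ∸ suc s) * (minus1 ^ u * V u) ∎

  pairE-twoRow : ∀ f m p s → m ≤ f → suc s < p → pairE f m (chainSum ψ₋₁ (p ∷ suc s ∷ [])) ≡ + 0
  pairE-twoRow-∷ : ∀ f m p s a → m ≤ f → suc s < p →
    pairE f m (λ δ → chainSum ψ₋₁ (p ∷ suc s ∷ []) (a ∷ δ))
      ≡ ⟦ sumℕ (p ∷ suc s ∷ []) ≟ a +ℕ m ⟧
        * ∑[ u < p ∸ s ] (ψ₋₁ (p ∷ suc s ∷ []) (row (suc s +ℕ u)) * ⟦ m ≟ suc s +ℕ u ⟧)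

  pairE-twoRow f       zero    p s _         _     = refl
  pairE-twoRow (suc f) (suc b) p s (s≤s b≤f) 1+s<p = begin
    pairE (suc f) (suc b) (chainSum ψ₋₁ ν)
      ≡⟨ ∑-cong (suc b) (λ i i<1+b → cong (minus1 ^ i *_) (strip i i<1+b)) ⟩
    ∑[ i < suc b ] (minus1 ^ i * (c * W i))
      ≡⟨ ∑-cong (suc b) (λ i _ → x*[y*z]≡y*[x*z] (minus1 ^ i) c (W i)) ⟩
    ∑[ i < suc b ] (c * (minus1 ^ i * W i))
      ≡⟨ ∑-*ˡ (suc b) c (λ i → minus1 ^ i * W i) ⟩
    c * ∑[ i < suc b ] (minus1 ^ i * W i)
      ≡⟨ ⟦⟧-guard (sumℕ ν ≟ suc b) (alternating-twoRow p s b 1+s<p) ⟩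
    c * + 0
      ≡⟨ ℤ.*-zeroʳ c ⟩
    + 0 ∎
    where
    open ≡-Reasoning
    ν : List ℕ
    ν = p ∷ suc s ∷ []
    c : ℤ
    c = ⟦ sumℕ ν ≟ suc b ⟧
    W : ℕ → ℤ
    W i = ∑[ u < p ∸ s ] (ψ₋₁ ν (row (suc s +ℕ u)) * ⟦ b ∸ i ≟ suc s +ℕ u ⟧)
    strip : ∀ i → i < suc b → pairE f (b ∸ i) (λ δ → chainSum ψ₋₁ ν (suc i ∷ δ)) ≡ c * W i
    strip i (s≤s i≤b) = trans (pairE-twoRow-∷ f (b ∸ i) p s (suc i) (ℕ.≤-trans (ℕ.m∸n≤m b i) b≤f) 1+s<p)
                              (cong (λ k → ⟦ sumℕ ν ≟ suc k ⟧ * W i) (ℕ.m+[n∸m]≡n i≤b))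

  pairE-twoRow-∷ f m p s a m≤f 1+s<p = begin
    pairE f m (λ δ → chainSum ψ₋₁ ν (a ∷ δ))
      ≡⟨ pairE-chainSum-twoRow ψ₋₁ f m p (suc s) a ⟩
    ∑[ u < p ∸ s ] ∑[ y < suc (suc s) ] stripTerm ψ₋₁ f m ν a (stripZ (suc s +ℕ u ∷ y ∷ []))
      ≡⟨ ∑-cong (p ∸ s) (λ u _ → ∑-single 0 z<s λ where
           zero    _               0≢0 → contradiction refl 0≢0
           (suc y) (s≤s (s≤s y≤s)) _   → taller-vanishes u y y≤s) ⟩
    ∑[ u < p ∸ s ] stripTerm ψ₋₁ f m ν a (row (suc s +ℕ u))
      ≡⟨ ∑-cong (p ∸ s) (λ u _ → trans
           (cong (λ v → ⟦ sumℕ ν ≟ a +ℕ sumℕ (row (suc s +ℕ u)) ⟧ * (V u * v)) (pairE-row f m (suc s +ℕ u) m≤f))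
           (strip-size-shift (sumℕ ν) a m (suc s +ℕ u) (V u))) ⟩
    ∑[ u < p ∸ s ] (⟦ sumℕ ν ≟ a +ℕ m ⟧ * (V u * ⟦ m ≟ suc s +ℕ u ⟧))
      ≡⟨ ∑-*ˡ (p ∸ s) ⟦ sumℕ ν ≟ a +ℕ m ⟧ (λ u → V u * ⟦ m ≟ suc s +ℕ u ⟧) ⟩
    ⟦ sumℕ ν ≟ a +ℕ m ⟧ * ∑[ u < p ∸ s ] (V u * ⟦ m ≟ suc s +ℕ u ⟧) ∎
    where
    open ≡-Reasoning
    ν : List ℕ
    ν = p ∷ suc s ∷ []
    V : ℕ → ℤ
    V u = ψ₋₁ ν (row (suc s +ℕ u))
    taller-vanishes : ∀ u y → y ≤ s → stripTerm ψ₋₁ f m ν a (suc s +ℕ u ∷ suc y ∷ []) ≡ + 0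
    taller-vanishes u y y≤s = trans (cong (⟦ sumℕ ν ≟ a +ℕ sumℕ ρ ⟧ *_) (vanish (ℕ.<-cmp y (s +ℕ u))))
                                    (ℤ.*-zeroʳ ⟦ sumℕ ν ≟ a +ℕ sumℕ ρ ⟧)
      where
      ρ : List ℕ
      ρ = suc s +ℕ u ∷ suc y ∷ []
      vanish : Tri (y < s +ℕ u) (y ≡ s +ℕ u) (s +ℕ u < y) → ψ₋₁ ν ρ * pairE f m (chainSum ψ₋₁ ρ) ≡ + 0
      vanish (tri< y<s+u _ _) =
        trans (cong (ψ₋₁ ν ρ *_) (pairE-twoRow f m (suc s +ℕ u) y m≤f (s≤s y<s+u))) (ℤ.*-zeroʳ (ψ₋₁ ν ρ))
      vanish (tri≈ _ y≡s+u _) = cong (_* pairE f m (chainSum ψ₋₁ ρ))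
        (subst (λ κ → ψ₋₁ ν κ ≡ + 0) (cong₂ (λ k l → suc k ∷ suc l ∷ []) (sym s+u≡s) (sym y≡s))
               (ψ₋₁-square-strip p (suc s) (s≤s z≤n) 1+s<p))
        where
        s+u≡s : s +ℕ u ≡ s
        s+u≡s = ℕ.≤-antisym (subst (_≤ s) y≡s+u y≤s) (ℕ.m≤m+n s u)
        y≡s : y ≡ s
        y≡s = trans y≡s+u s+u≡s
      vanish (tri> _ _ s+u<y) = contradiction (ℕ.≤-trans y≤s (ℕ.m≤m+n s u)) (ℕ.<⇒≱ s+u<y)

  pairE-square-strips : ∀ r j a → 1 ≤ a →
    pairE j j (λ δ → chainSum ψ₋₁ (r ∷ r ∷ []) (a ∷ δ)) ≡ stripTerm ψ₋₁ j j (r ∷ r ∷ []) a (row r)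
  pairE-square-strips r j a 1≤a = begin
    pairE j j (λ δ → chainSum ψ₋₁ R (a ∷ δ))
      ≡⟨ pairE-chainSum-twoRow ψ₋₁ j j r r a ⟩
    ∑[ u < suc r ∸ r ] ∑[ y < suc r ] stripTerm ψ₋₁ j j R a (stripZ (r +ℕ u ∷ y ∷ []))
      ≡⟨ cong (λ n → ∑[ u < n ] ∑[ y < suc r ] stripTerm ψ₋₁ j j R a (stripZ (r +ℕ u ∷ y ∷ []))) 1+r∸r≡1 ⟩
    ∑[ u < 1 ] ∑[ y < suc r ] stripTerm ψ₋₁ j j R a (stripZ (r +ℕ u ∷ y ∷ []))
      ≡⟨ ∑-one (λ u → ∑[ y < suc r ] stripTerm ψ₋₁ j j R a (stripZ (r +ℕ u ∷ y ∷ []))) ⟩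
    ∑[ y < suc r ] stripTerm ψ₋₁ j j R a (stripZ (r +ℕ 0 ∷ y ∷ []))
      ≡⟨ ∑-single 0 z<s (λ where
           zero    _         0≢0 → contradiction refl 0≢0
           (suc y) (s≤s y<r) _   → taller-vanishes y y<r) ⟩
    stripTerm ψ₋₁ j j R a (row (r +ℕ 0))
      ≡⟨ cong (λ k → stripTerm ψ₋₁ j j R a (row k)) (ℕ.+-identityʳ r) ⟩
    stripTerm ψ₋₁ j j R a (row r) ∎
    where
    open ≡-Reasoning
    R : List ℕ
    R = r ∷ r ∷ []
    1+r∸r≡1 : suc r ∸ r ≡ 1
    1+r∸r≡1 = trans (ℕ.+-∸-assoc 1 (ℕ.≤-refl {r})) (cong suc (ℕ.n∸n≡0 r))
    taller-vanishes : ∀ y → suc y ≤ r → stripTerm ψ₋₁ j j R a (r +ℕ 0 ∷ suc y ∷ []) ≡ + 0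
    taller-vanishes y 1+y≤r with ℕ.m≤n⇒m<n∨m≡n 1+y≤r
    ... | inj₁ 1+y<r = trans (cong (λ v → ⟦ sumℕ R ≟ a +ℕ sumℕ ρ ⟧ * (ψ₋₁ R ρ * v))
                                   (pairE-twoRow j j (r +ℕ 0) y ℕ.≤-refl (subst (suc y <_) (sym (ℕ.+-identityʳ r)) 1+y<r)))
                            (trans (cong (⟦ sumℕ R ≟ a +ℕ sumℕ ρ ⟧ *_) (ℤ.*-zeroʳ (ψ₋₁ R ρ)))
                                   (ℤ.*-zeroʳ ⟦ sumℕ R ≟ a +ℕ sumℕ ρ ⟧))
      where
      ρ : List ℕ
      ρ = r +ℕ 0 ∷ suc y ∷ []
    ... | inj₂ 1+y≡r = cong (_* (ψ₋₁ R ρ * pairE j j (chainSum ψ₋₁ ρ)))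
      (⟦⟧-no (sumℕ R ≟ a +ℕ sumℕ ρ) λ |R|≡a+|ρ| →
            ℕ.<-irrefl (trans |R|≡a+|ρ| (cong (a +ℕ_) |ρ|≡|R|)) (ℕ.m<n+m (sumℕ R) 1≤a))
      where
      ρ : List ℕ
      ρ = r +ℕ 0 ∷ suc y ∷ []
      |ρ|≡|R| : sumℕ ρ ≡ sumℕ R
      |ρ|≡|R| = cong₂ _+ℕ_ (ℕ.+-identityʳ r) (cong (_+ℕ 0) 1+y≡r)

  pairE-square : ∀ r j a → 1 ≤ a → a +ℕ j ≡ r +ℕ r →
    pairE j j (λ δ → chainSum ψ₋₁ (r ∷ r ∷ []) (a ∷ δ)) ≡ ⟦ j ≟ r ⟧
  pairE-square r j a 1≤a a+j≡r+r = begin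
    pairE j j (λ δ → chainSum ψ₋₁ R (a ∷ δ))
      ≡⟨ pairE-square-strips r j a 1≤a ⟩
    ⟦ sumℕ R ≟ a +ℕ sumℕ (row r) ⟧ * (ψ₋₁ R (row r) * pairE j j (chainSum ψ₋₁ (row r)))
      ≡⟨ cong₂ (λ v w → ⟦ sumℕ R ≟ a +ℕ sumℕ (row r) ⟧ * (v * w))
               (ψ₋₁-twoRow-row-flat r r r ℕ.≤-refl ℕ.≤-refl (λ (r<r , _) → ℕ.<-irrefl refl r<r))
               (pairE-row j j r ℕ.≤-refl) ⟩
    ⟦ sumℕ R ≟ a +ℕ sumℕ (row r) ⟧ * (+ 1 * ⟦ j ≟ r ⟧)
      ≡⟨ trans (cong (⟦ sumℕ R ≟ a +ℕ sumℕ (row r) ⟧ *_) (ℤ.*-identityˡ ⟦ j ≟ r ⟧))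
               (ℤ.*-comm ⟦ sumℕ R ≟ a +ℕ sumℕ (row r) ⟧ ⟦ j ≟ r ⟧) ⟩
    ⟦ j ≟ r ⟧ * ⟦ sumℕ R ≟ a +ℕ sumℕ (row r) ⟧
      ≡⟨ ⟦⟧-guard (j ≟ r) (λ j≡r → ⟦⟧-yes (sumℕ R ≟ a +ℕ sumℕ (row r)) (sized j≡r)) ⟩
    ⟦ j ≟ r ⟧ * + 1
      ≡⟨ ℤ.*-identityʳ ⟦ j ≟ r ⟧ ⟩
    ⟦ j ≟ r ⟧ ∎
    where
    open ≡-Reasoning
    R : List ℕ
    R = r ∷ r ∷ []
    sized : j ≡ r → sumℕ R ≡ a +ℕ sumℕ (row r)
    sized j≡r = trans (cong (r +ℕ_) (ℕ.+-identityʳ r))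
                      (trans (sym a+j≡r+r) (cong (a +ℕ_) (trans j≡r (sym (sumℕ-row r)))))

  -- The hook recurrence

  x+y≡z⇒x≡z-y : ∀ {x y z} → x + y ≡ z → x ≡ z - y
  x+y≡z⇒x≡z-y {x} {y} {z} x+y≡z = begin
    x                ≡⟨ sym (ℤ.+-identityʳ x) ⟩
    x + + 0          ≡⟨ cong (_+_ x) (sym (ℤ.+-inverseʳ y)) ⟩
    x + (y - y)      ≡⟨ sym (ℤ.+-assoc x y (- y)) ⟩
    x + y - y        ≡⟨ cong (_- y) x+y≡z ⟩
    z - y            ∎
    where open ≡-Reasoning

  alternating-recurrence : ∀ (a : ℕ → ℤ) r N → (∀ j → j < N → a j + prev a j ≡ ⟦ j ≟ r ⟧) →
    ∀ j → j < N → (j < r → a j ≡ + 0) × (r ≤ j → a j ≡ minus1 ^ (r +ℕ j))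
  alternating-recurrence a r N rec zero 0<N = below , above
    where
    a₀≡[0≡r] : a 0 ≡ ⟦ 0 ≟ r ⟧
    a₀≡[0≡r] = trans (sym (ℤ.+-identityʳ (a 0))) (rec 0 0<N)
    below : 0 < r → a 0 ≡ + 0
    below 0<r = trans a₀≡[0≡r] (⟦⟧-no (0 ≟ r) (ℕ.<⇒≢ 0<r))
    above : r ≤ 0 → a 0 ≡ minus1 ^ (r +ℕ 0)
    above z≤n = a₀≡[0≡r]
  alternating-recurrence a r N rec (suc j) 1+j<N = below , above
    where
    previous : (j < r → a j ≡ + 0) × (r ≤ j → a j ≡ minus1 ^ (r +ℕ j))
    previous = alternating-recurrence a r N rec j (ℕ.<-trans (ℕ.n<1+n j) 1+j<N)
    step : a (suc j) ≡ ⟦ suc j ≟ r ⟧ - a j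
    step = x+y≡z⇒x≡z-y (rec (suc j) 1+j<N)
    below : suc j < r → a (suc j) ≡ + 0
    below 1+j<r = trans step (cong₂ _-_ (⟦⟧-no (suc j ≟ r) (ℕ.<⇒≢ 1+j<r))
                                        (proj₁ previous (ℕ.<-trans (ℕ.n<1+n j) 1+j<r)))
    above : r ≤ suc j → a (suc j) ≡ minus1 ^ (r +ℕ suc j)
    above r≤1+j with ℕ.m≤n⇒m<n∨m≡n r≤1+j
    ... | inj₁ (s≤s r≤j) = begin
      a (suc j)                     ≡⟨ step ⟩
      ⟦ suc j ≟ r ⟧ - a j           ≡⟨ cong₂ _-_ (⟦⟧-no (suc j ≟ r) (ℕ.<⇒≢ (s≤s r≤j) ∘ sym)) (proj₂ previous r≤j) ⟩
      + 0 - minus1 ^ (r +ℕ j)       ≡⟨ ℤ.+-identityˡ _ ⟩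
      - minus1 ^ (r +ℕ j)           ≡⟨ sym (minus1^-suc (r +ℕ j)) ⟩
      minus1 ^ suc (r +ℕ j)         ≡⟨ cong (minus1 ^_) (sym (ℕ.+-suc r j)) ⟩
      minus1 ^ (r +ℕ suc j)         ∎
      where open ≡-Reasoning
    ... | inj₂ refl = begin
      a (suc j)                     ≡⟨ step ⟩
      ⟦ suc j ≟ suc j ⟧ - a j       ≡⟨ cong₂ _-_ (⟦⟧-yes (suc j ≟ suc j) refl) (proj₁ previous (ℕ.n<1+n j)) ⟩
      + 1                           ≡⟨ sym (minus1^-even (suc j)) ⟩
      minus1 ^ (suc j +ℕ suc j)     ∎
      where open ≡-Reasoning

  hook-recurrence : ∀ r (g : List ℕ → ℤ) → IsSchurExpansion (r ∷ r ∷ []) (2 *ℕ r) g →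
    ∀ j → j < 2 *ℕ r → g (hook (2 *ℕ r) j) + prev (g ∘ hook (2 *ℕ r)) j ≡ ⟦ j ≟ r ⟧
  hook-recurrence r g expansion j j<n = begin
    g (hook n j) + prev (g ∘ hook n) j
      ≡⟨ sym (pairE-schurExpansion n j g j<n) ⟩
    pairE j j (λ δ → sumℤ (map (λ κ → g κ * coeffS κ (reverse (n ∸ j ∷ δ))) (partitions n)))
      ≡⟨ pairE-cong j j (λ δ → sym (expansion (reverse (n ∸ j ∷ δ)))) ⟩
    pairE j j (λ δ → coeffP minus1 (r ∷ r ∷ []) (reverse (n ∸ j ∷ δ)))
      ≡⟨ pairE-cong j j (λ δ → cong (chainSum ψ₋₁ (r ∷ r ∷ [])) (List.reverse-involutive (n ∸ j ∷ δ))) ⟩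
    pairE j j (λ δ → chainSum ψ₋₁ (r ∷ r ∷ []) (n ∸ j ∷ δ))
      ≡⟨ pairE-square r j (n ∸ j) (ℕ.m<n⇒0<n∸m j<n)
           (trans (ℕ.m∸n+n≡m (ℕ.<⇒≤ j<n)) (cong (r +ℕ_) (ℕ.+-identityʳ r))) ⟩
    ⟦ j ≟ r ⟧ ∎
    where
    open ≡-Reasoning
    n : ℕ
    n = 2 *ℕ r

open import Data.Nat using (ℕ; _+_; _*_; _<_; _≤_)
open import Data.List using (List; _∷_; [])
open import Data.Integer using (ℤ; +_; _^_)
open import Data.Product using (_×_)
open import Relation.Binary.PropositionalEquality using (_≡_)
open import Function using (_∘_)
open HookRecurrence using (alternating-recurrence; hook-recurrence)

theorem4p7 : (r : ℕ) → 1 ≤ r → (j : ℕ) → j < 2 * r →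
    (g : List ℕ → ℤ) → IsSchurExpansion (r ∷ r ∷ []) (2 * r) g →
    (j < r → g (hook (2 * r) j) ≡ + 0) ×
    (r ≤ j → g (hook (2 * r) j) ≡ minus1 ^ (r + j))
theorem4p7 r _ j j<2r g expansion =
  alternating-recurrence (g ∘ hook (2 * r)) r (2 * r) (hook-recurrence r g expansion) j j<2r
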